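{- Every deduction in the natural deduction system $\mathbf{IPF}$ of intuitionist positive free logic can be transformed into a deduction in normal form, i.e. one containing neither maximal formulas nor maximal segments, with the same conclusion and with undischarged assumptions among those of the original deduction.
   Context: $\mathbf{IPF}$ is a natural deduction system for a first-order language without function symbols whose terms are constants and parameters (free variables), with a primitive one-place predicate $\exists!$ (read "exists"), identity $=$, and connectives $\land,\lor,\rightarrow,\leftrightarrow,\bot,\forall,\exists$. $A^x_t$ denotes the result of replacing $x$ by $t$ in $A$. Rules: the standard intuitionist introduction and elimination rules for $\land$, $\rightarrow$, $\lor$ (with $\lor E$: from $A\lor B$, a deduction of $C$ from $A$ and a deduction of $C$ from $B$, infer $C$, discharging $A$ and $B$) and $\leftrightarrow$ ($\leftrightarrow I$: from a deduction of $B$ from $A$ and one of $A$ from $B$ infer $A\leftrightarrow B$ discharging both; $\leftrightarrow E$: from $A\leftrightarrow B$ and $A$ infer $B$, and from $A\leftrightarrow B$ and $B$ infer $A$); $\bot E$: from $\bot$ infer any atomic formula. $\forall I$: from a deduction of $A^x_a$ from assumptions including $\exists! a$, infer $\forall x A$, discharging $\exists!a$, where $a$ does not occur in $A$ nor in any other undischarged assumption. $\forall E$: from $\forall xA$ and $\exists!t$ infer $A^x_t$. $\exists I$: from $A^x_t$ and $\exists!t$ infer $\exists xA$. $\exists E$: from $\exists xA$ and a deduction of $C$ from $A^x_a$ and $\exists!a$, infer $C$ discharging $A^x_a,\exists!a$, where $a$ does not occur in $A$, $C$, or other undischarged assumptions. $=I$: $t=t$ is an axiom for every term $t$. $=E$: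 from $t_1=t_2$ and $A^x_{t_1}$ infer $A^x_{t_2}$, for atomic $A$ and distinct $t_1,t_2$. The major premise of an elimination rule is the premise containing the governed connective (the first premise listed). A maximal formula is a formula occurrence that is the conclusion of an introduction rule and the major premise of an elimination rule. The del-rules are $\lor E$ and $\exists E$. A segment is a sequence $C_1,\dots,C_n$ ($n\ge2$) of occurrences of the same formula such that $C_1$ is not the conclusion of a del-rule, $C_n$ is not a minor premise of a del-rule, and each $C_i$ ($i<n$) is a minor premise of a del-rule whose conclusion is $C_{i+1}$; it is maximal if $C_n$ is the major premise of an elimination rule. -}

module Defs where

open import Data.Nat using (ℕ; zero; suc; _<_; _≤_; _≡ᵇ_)
open import Data.Bool using (Bool; true; false; if_then_else_)
open import Data.List using (List; []; _∷_; map; _++_)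
open import Data.List.Membership.Propositional using (_∈_)
open import Data.List.Relation.Unary.All using (All)
open import Data.Product using (Σ; _×_; _,_; ∃)
open import Data.Maybe using (Maybe; just; nothing)
open import Data.Empty using (⊥)
open import Data.Unit using (⊤)
open import Relation.Binary.PropositionalEquality using (_≡_; _≢_)
open import Relation.Nullary using (¬_)

-- Language: no function symbols. Closed terms are constants and
-- parameters (free variables); bound variables are de Bruijn indices
-- (locally nameless representation).

data Term : Set where
  con : ℕ → Term
  par : ℕ → Term

data FTerm : Set where
  bv : ℕ → FTerm
  tm : Term → FTerm

infixr 6 _∧'_
infixr 5 _∨'_
infixr 4 _⇒'_ _⇔'_
infix  7 _≐_

data Formula : Set where
  rel   : ℕ → List FTerm → Formula
  E!    : FTerm → Formula
  _≐_   : FTerm → FTerm → Formula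
  ⊥'    : Formula
  _∧'_  : Formula → Formula → Formula
  _∨'_  : Formula → Formula → Formula
  _⇒'_  : Formula → Formula → Formula
  _⇔'_  : Formula → Formula → Formula
  ∀'    : Formula → Formula           -- ∀x A, x = bv 0 in the body
  ∃'    : Formula → Formula

-- atomic formulas (⊥ is treated as a logical constant, not atomic)
data Atomic : Formula → Set where
  rel : ∀ n ts → Atomic (rel n ts)
  E!  : ∀ t → Atomic (E! t)
  eq  : ∀ s t → Atomic (s ≐ t)

substT : ℕ → Term → FTerm → FTerm
substT k t (bv i) = if i ≡ᵇ k then tm t else bv i
substT k t (tm s) = tm s

subst : ℕ → Term → Formula → Formula
subst k t (rel n ts) = rel n (map (substT k t) ts)
subst k t (E! s)     = E! (substT k t s)
subst k t (s ≐ r)    = substT k t s ≐ substT k t r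
subst k t ⊥'         = ⊥'
subst k t (A ∧' B)   = subst k t A ∧' subst k t B
subst k t (A ∨' B)   = subst k t A ∨' subst k t B
subst k t (A ⇒' B)   = subst k t A ⇒' subst k t B
subst k t (A ⇔' B)   = subst k t A ⇔' subst k t B
subst k t (∀' A)     = ∀' (subst (suc k) t A)
subst k t (∃' A)     = ∃' (subst (suc k) t A)

-- A [ t ] is A^x_t where A is the body of a quantifier ∀x A / ∃x A
_[_] : Formula → Term → Formula
A [ t ] = subst 0 t A

-- well-formedness: bound variables only below k binders; Closed = sentence
WFT : ℕ → FTerm → Set
WFT k (bv i) = i < k
WFT k (tm t) = ⊤

WF : ℕ → Formula → Set
WF k (rel n ts) = All (WFT k) ts
WF k (E! s)     = WFT k s
WF k (s ≐ r)    = WFT k s × WFT k r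
WF k ⊥'         = ⊤
WF k (A ∧' B)   = WF k A × WF k B
WF k (A ∨' B)   = WF k A × WF k B
WF k (A ⇒' B)   = WF k A × WF k B
WF k (A ⇔' B)   = WF k A × WF k B
WF k (∀' A)     = WF (suc k) A
WF k (∃' A)     = WF (suc k) A

Closed : Formula → Set
Closed = WF 0

parsT : FTerm → List ℕ
parsT (tm (par a)) = a ∷ []
parsT _            = []

parsL : List FTerm → List ℕ
parsL []       = []
parsL (t ∷ ts) = parsT t ++ parsL ts

pars : Formula → List ℕ
pars (rel n ts) = parsL ts
pars (E! s)     = parsT s
pars (s ≐ r)    = parsT s ++ parsT r
pars ⊥'         = []
pars (A ∧' B)   = pars A ++ pars B
pars (A ∨' B)   = pars A ++ pars B
pars (A ⇒' B)   = pars A ++ pars B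
pars (A ⇔' B)   = pars A ++ pars B
pars (∀' A)     = pars A
pars (∃' A)     = pars A

_occursIn_ : ℕ → Formula → Set
a occursIn A = a ∈ pars A

-- Assumption occurrences carry a
-- discharge label; a discharging rule with label u discharges all
-- open occurrences of the relevant formula carrying label u (possibly
-- none: vacuous discharge).

Label : Set
Label = ℕ

data Der : Formula → Set where
  ass  : (u : Label) (A : Formula) → Der A
  ∧I   : ∀ {A B} → Der A → Der B → Der (A ∧' B)
  ∧E₁  : ∀ {A B} → Der (A ∧' B) → Der A
  ∧E₂  : ∀ {A B} → Der (A ∧' B) → Der B
  ⇒I   : ∀ {B} (u : Label) (A : Formula) → Der B → Der (A ⇒' B)
  ⇒E   : ∀ {A B} → Der (A ⇒' B) → Der A → Der B
  ∨I₁  : ∀ {A} (B : Formula) → Der A → Der (A ∨' B)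
  ∨I₂  : ∀ {B} (A : Formula) → Der B → Der (A ∨' B)
  ∨E   : ∀ {A B C} (u v : Label) → Der (A ∨' B) → Der C → Der C → Der C
  ⇔I   : (u v : Label) (A B : Formula) → Der B → Der A → Der (A ⇔' B)
  ⇔E₁  : ∀ {A B} → Der (A ⇔' B) → Der A → Der B
  ⇔E₂  : ∀ {A B} → Der (A ⇔' B) → Der B → Der A
  ⊥E   : (A : Formula) → Der ⊥' → Der A
  allI : ∀ {A} (u : Label) (a : ℕ) → Der (A [ par a ]) → Der (∀' A)
  allE : ∀ {A} (t : Term) → Der (∀' A) → Der (E! (tm t)) → Der (A [ t ])
  exI  : (A : Formula) (t : Term) → Der (A [ t ]) → Der (E! (tm t)) → Der (∃' A)
  exE  : ∀ {A C} (u v : Label) (a : ℕ) → Der (∃' A) → Der C → Der C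
  ≐I   : (t : Term) → Der (tm t ≐ tm t)
  ≐E   : (A : Formula) (t₁ t₂ : Term) → Der (tm t₁ ≐ tm t₂) → Der (A [ t₁ ])
         → Der (A [ t₂ ])

infix 4 _∈ass_
data _∈ass_ : ∀ {C} → Label × Formula → Der C → Set where
  ass  : ∀ {u A} → (u , A) ∈ass ass u A
  ∧I₁  : ∀ {p A B} {d : Der A} {e : Der B} → p ∈ass d → p ∈ass ∧I d e
  ∧I₂  : ∀ {p A B} {d : Der A} {e : Der B} → p ∈ass e → p ∈ass ∧I d e
  ∧E₁  : ∀ {p A B} {d : Der (A ∧' B)} → p ∈ass d → p ∈ass ∧E₁ d
  ∧E₂  : ∀ {p A B} {d : Der (A ∧' B)} → p ∈ass d → p ∈ass ∧E₂ d
  ⇒I   : ∀ {p u A B} {d : Der B} → p ∈ass d → p ≢ (u , A) → p ∈ass ⇒I u A d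
  ⇒E₁  : ∀ {p A B} {d : Der (A ⇒' B)} {e : Der A} → p ∈ass d → p ∈ass ⇒E d e
  ⇒E₂  : ∀ {p A B} {d : Der (A ⇒' B)} {e : Der A} → p ∈ass e → p ∈ass ⇒E d e
  ∨I₁  : ∀ {p A B} {d : Der A} → p ∈ass d → p ∈ass ∨I₁ B d
  ∨I₂  : ∀ {p A B} {d : Der B} → p ∈ass d → p ∈ass ∨I₂ A d
  ∨E₀  : ∀ {p u v A B C} {d : Der (A ∨' B)} {e f : Der C}
         → p ∈ass d → p ∈ass ∨E u v d e f
  ∨E₁  : ∀ {p u v A B C} {d : Der (A ∨' B)} {e f : Der C}
         → p ∈ass e → p ≢ (u , A) → p ∈ass ∨E u v d e f
  ∨E₂  : ∀ {p u v A B C} {d : Der (A ∨' B)} {e f : Der C}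
         → p ∈ass f → p ≢ (v , B) → p ∈ass ∨E u v d e f
  ⇔I₁  : ∀ {p u v A B} {d : Der B} {e : Der A}
         → p ∈ass d → p ≢ (u , A) → p ∈ass ⇔I u v A B d e
  ⇔I₂  : ∀ {p u v A B} {d : Der B} {e : Der A}
         → p ∈ass e → p ≢ (v , B) → p ∈ass ⇔I u v A B d e
  ⇔E₁₁ : ∀ {p A B} {d : Der (A ⇔' B)} {e : Der A} → p ∈ass d → p ∈ass ⇔E₁ d e
  ⇔E₁₂ : ∀ {p A B} {d : Der (A ⇔' B)} {e : Der A} → p ∈ass e → p ∈ass ⇔E₁ d e
  ⇔E₂₁ : ∀ {p A B} {d : Der (A ⇔' B)} {e : Der B} → p ∈ass d → p ∈ass ⇔E₂ d e
  ⇔E₂₂ : ∀ {p A B} {d : Der (A ⇔' B)} {e : Der B} → p ∈ass e → p ∈ass ⇔E₂ d e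
  ⊥E   : ∀ {p A} {d : Der ⊥'} → p ∈ass d → p ∈ass ⊥E A d
  allI : ∀ {p u a A} {d : Der (A [ par a ])}
         → p ∈ass d → p ≢ (u , E! (tm (par a))) → p ∈ass allI u a d
  allE₁ : ∀ {p A t} {d : Der (∀' A)} {e : Der (E! (tm t))}
         → p ∈ass d → p ∈ass allE t d e
  allE₂ : ∀ {p A t} {d : Der (∀' A)} {e : Der (E! (tm t))}
         → p ∈ass e → p ∈ass allE t d e
  exI₁ : ∀ {p A t} {d : Der (A [ t ])} {e : Der (E! (tm t))}
         → p ∈ass d → p ∈ass exI A t d e
  exI₂ : ∀ {p A t} {d : Der (A [ t ])} {e : Der (E! (tm t))}
         → p ∈ass e → p ∈ass exI A t d e
  exE₀ : ∀ {p u v a A C} {d : Der (∃' A)} {e : Der C}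
         → p ∈ass d → p ∈ass exE u v a d e
  exE₁ : ∀ {p u v a A C} {d : Der (∃' A)} {e : Der C}
         → p ∈ass e → p ≢ (u , A [ par a ]) → p ≢ (v , E! (tm (par a)))
         → p ∈ass exE u v a d e
  ≐E₁  : ∀ {p A t₁ t₂} {d : Der (tm t₁ ≐ tm t₂)} {e : Der (A [ t₁ ])}
         → p ∈ass d → p ∈ass ≐E A t₁ t₂ d e
  ≐E₂  : ∀ {p A t₁ t₂} {d : Der (tm t₁ ≐ tm t₂)} {e : Der (A [ t₁ ])}
         → p ∈ass e → p ∈ass ≐E A t₁ t₂ d e

-- Correctness of a deduction: every formula occurrence is a sentence,
-- and the side conditions of ⊥E, ∀I, ∃E, =E hold.

data IsDed : ∀ {C} → Der C → Set where
  ass  : ∀ {u A} → Closed A → IsDed (ass u A)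
  ∧I   : ∀ {A B} {d : Der A} {e : Der B} → Closed (A ∧' B)
         → IsDed d → IsDed e → IsDed (∧I d e)
  ∧E₁  : ∀ {A B} {d : Der (A ∧' B)} → Closed A → IsDed d → IsDed (∧E₁ d)
  ∧E₂  : ∀ {A B} {d : Der (A ∧' B)} → Closed B → IsDed d → IsDed (∧E₂ d)
  ⇒I   : ∀ {u A B} {d : Der B} → Closed (A ⇒' B) → IsDed d → IsDed (⇒I u A d)
  ⇒E   : ∀ {A B} {d : Der (A ⇒' B)} {e : Der A} → Closed B
         → IsDed d → IsDed e → IsDed (⇒E d e)
  ∨I₁  : ∀ {A B} {d : Der A} → Closed (A ∨' B) → IsDed d → IsDed (∨I₁ B d)
  ∨I₂  : ∀ {A B} {d : Der B} → Closed (A ∨' B) → IsDed d → IsDed (∨I₂ A d)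
  ∨E   : ∀ {u v A B C} {d : Der (A ∨' B)} {e f : Der C} → Closed C
         → IsDed d → IsDed e → IsDed f → IsDed (∨E u v d e f)
  ⇔I   : ∀ {u v A B} {d : Der B} {e : Der A} → Closed (A ⇔' B)
         → IsDed d → IsDed e → IsDed (⇔I u v A B d e)
  ⇔E₁  : ∀ {A B} {d : Der (A ⇔' B)} {e : Der A} → Closed B
         → IsDed d → IsDed e → IsDed (⇔E₁ d e)
  ⇔E₂  : ∀ {A B} {d : Der (A ⇔' B)} {e : Der B} → Closed A
         → IsDed d → IsDed e → IsDed (⇔E₂ d e)
  ⊥E   : ∀ {A} {d : Der ⊥'} → Closed A → Atomic A → IsDed d → IsDed (⊥E A d)
  allI : ∀ {u a A} {d : Der (A [ par a ])} → Closed (∀' A)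
         → ¬ (a occursIn A)
         → (∀ {v B} → (v , B) ∈ass allI u a d → ¬ (a occursIn B))
         → IsDed d → IsDed (allI u a d)
  allE : ∀ {A t} {d : Der (∀' A)} {e : Der (E! (tm t))} → Closed (A [ t ])
         → IsDed d → IsDed e → IsDed (allE t d e)
  exI  : ∀ {A t} {d : Der (A [ t ])} {e : Der (E! (tm t))} → Closed (∃' A)
         → IsDed d → IsDed e → IsDed (exI A t d e)
  exE  : ∀ {u v a A C} {d : Der (∃' A)} {e : Der C} → Closed C
         → ¬ (a occursIn A) → ¬ (a occursIn C)
         → (∀ {p} → p ∈ass e → p ≢ (u , A [ par a ]) → p ≢ (v , E! (tm (par a)))
              → ¬ (a occursIn Data.Product.proj₂ p))
         → IsDed d → IsDed e → IsDed (exE u v a d e)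
  ≐I   : ∀ {t} → IsDed (≐I t)
  ≐E   : ∀ {A t₁ t₂} {d : Der (tm t₁ ≐ tm t₂)} {e : Der (A [ t₁ ])}
         → Closed (A [ t₂ ]) → Atomic A → t₁ ≢ t₂
         → IsDed d → IsDed e → IsDed (≐E A t₁ t₂ d e)

Ded : Set
Ded = Σ Formula Der

children : ∀ {C} → Der C → List Ded
children (ass u A)          = []
children (∧I d e)           = (_ , d) ∷ (_ , e) ∷ []
children (∧E₁ d)            = (_ , d) ∷ []
children (∧E₂ d)            = (_ , d) ∷ []
children (⇒I u A d)         = (_ , d) ∷ []
children (⇒E d e)           = (_ , d) ∷ (_ , e) ∷ []
children (∨I₁ B d)          = (_ , d) ∷ []
children (∨I₂ A d)          = (_ , d) ∷ []
children (∨E u v d e f)     = (_ , d) ∷ (_ , e) ∷ (_ , f) ∷ []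
children (⇔I u v A B d e)   = (_ , d) ∷ (_ , e) ∷ []
children (⇔E₁ d e)          = (_ , d) ∷ (_ , e) ∷ []
children (⇔E₂ d e)          = (_ , d) ∷ (_ , e) ∷ []
children (⊥E A d)           = (_ , d) ∷ []
children (allI u a d)       = (_ , d) ∷ []
children (allE t d e)       = (_ , d) ∷ (_ , e) ∷ []
children (exI A t d e)      = (_ , d) ∷ (_ , e) ∷ []
children (exE u v a d e)    = (_ , d) ∷ (_ , e) ∷ []
children (≐I t)             = []
children (≐E A t₁ t₂ d e)   = (_ , d) ∷ (_ , e) ∷ []

infix 4 _≼_
data _≼_ : Ded → Ded → Set where
  here  : ∀ {x} → x ≼ x
  there : ∀ {x y z} → y ∈ children (Data.Product.proj₂ z) → x ≼ y → x ≼ z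

isIntro : ∀ {C} → Der C → Bool
isIntro (∧I _ _)           = true
isIntro (⇒I _ _ _)         = true
isIntro (∨I₁ _ _)          = true
isIntro (∨I₂ _ _)          = true
isIntro (⇔I _ _ _ _ _ _)   = true
isIntro (allI _ _ _)       = true
isIntro (exI _ _ _ _)      = true
isIntro (≐I _)             = true
isIntro _                  = false

isDel : ∀ {C} → Der C → Bool
isDel (∨E _ _ _ _ _)  = true
isDel (exE _ _ _ _ _) = true
isDel _               = false

major : ∀ {C} → Der C → Maybe Ded
major (∧E₁ d)            = just (_ , d)
major (∧E₂ d)            = just (_ , d)
major (⇒E d e)           = just (_ , d)
major (∨E u v d e f)     = just (_ , d)
major (⇔E₁ d e)          = just (_ , d)
major (⇔E₂ d e)          = just (_ , d)
major (⊥E A d)           = just (_ , d)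
major (allE t d e)       = just (_ , d)
major (exE u v a d e)    = just (_ , d)
major (≐E A t₁ t₂ d e)   = just (_ , d)
major _                  = nothing

MaximalFormulaAtRoot : Ded → Set
MaximalFormulaAtRoot (_ , d) =
  Σ Ded λ m → major d ≡ just m × isIntro (Data.Product.proj₂ m) ≡ true

-- SegUp d n : the end formula occurrence of d is the last member C_n of a
-- sequence C₁,…,C_n of occurrences of the same formula in which C₁ is not
-- the conclusion of a del-rule and each C_i (i<n) is a minor premise of a
-- del-rule whose conclusion is C_{i+1}.
data SegUp : ∀ {C} → Der C → ℕ → Set where
  start : ∀ {C} {d : Der C} → isDel d ≡ false → SegUp d 1
  ∨E₁   : ∀ {u v A B C n} {d : Der (A ∨' B)} {e f : Der C}
          → SegUp e n → SegUp (∨E u v d e f) (suc n)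
  ∨E₂   : ∀ {u v A B C n} {d : Der (A ∨' B)} {e f : Der C}
          → SegUp f n → SegUp (∨E u v d e f) (suc n)
  exE   : ∀ {u v a A C n} {d : Der (∃' A)} {e : Der C}
          → SegUp e n → SegUp (exE u v a d e) (suc n)

-- a maximal segment (n ≥ 2) ends in the major premise of the last rule of x
-- (C_n is then a major premise, hence not a minor premise of a del-rule)
MaximalSegmentAtRoot : Ded → Set
MaximalSegmentAtRoot (_ , d) =
  Σ Ded λ m → major d ≡ just m × Σ ℕ λ n → 2 ≤ n × SegUp (Data.Product.proj₂ m) n

Normal : ∀ {C} → Der C → Set
Normal {C} d = ∀ x → x ≼ (C , d) → ¬ MaximalFormulaAtRoot x × ¬ MaximalSegmentAtRoot x

{-# OPTIONS --safe #-}
module Submission where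

-- Normalisation by evaluation.  Formulas are interpreted in a Kripke model
-- whose worlds are sets of hypotheses together with a bound on the parameters
-- in use.  Atoms and ⊥ hold when they have a neutral deduction, i.e. a chain
-- of eliminations whose major premises are never conclusions of introductions
-- or of del-rules; disjunctions and existentials hold after finitely many case
-- splits (∨E, ∃E) on neutral deductions.  Every correct deduction is sound for
-- this model, and reading a semantic value back yields a deduction in which all
-- major premises are neutral, so it has neither maximal formulas nor maximal
-- segments.  New eigenparameters are chosen above the bound, which secures the
-- side conditions of ∀I and ∃E, and the open assumptions of the result are
-- hypotheses of the initial world, namely the open assumptions of the input.

open import Defs
open import Data.Bool using (true; false; T)
open import Data.Empty using (⊥-elim)
open import Data.List using (List; []; _∷_; map; _++_; concatMap; filter)
open import Data.List.Extrema.Nat using (max; xs≤max)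
open import Data.List.Membership.Propositional using (_∈_)
open import Data.List.Membership.Propositional.Properties using (∈-++⁺ˡ; ∈-++⁺ʳ; ∈-++⁻; ∈-filter⁺; ∈-filter⁻)
open import Data.List.Properties using (map-id; map-cong; map-∘)
open import Data.List.Relation.Unary.All as All using (All; []; _∷_)
open import Data.List.Relation.Unary.All.Properties using (++⁺; ++⁻ˡ; ++⁻ʳ; map⁺; map⁻; concat⁻)
open import Data.List.Relation.Unary.Any using (here; there)
open import Data.List.Relation.Binary.Subset.Propositional using (_⊆_)
open import Data.Maybe using (just)
open import Data.Nat using (ℕ; suc; _<_; _≤_; _≡ᵇ_; s≤s)
open import Data.Nat.Properties using (≤-refl; ≤-trans; <-≤-trans; <-irrefl; n≤1+n; ≤-pred; ≤∧≢⇒<; ≡⇒≡ᵇ)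
import Data.Nat.Properties as ℕ
open import Data.Product using (Σ; _×_; _,_; ∃; proj₁; proj₂)
open import Data.Product.Properties using (≡-dec)
open import Data.Sum using (_⊎_; inj₁; inj₂)
open import Data.Unit using (tt)
open import Function using (_∘_)
open import Relation.Nullary using (¬_; Dec; yes; no; ¬?)
open import Relation.Binary.PropositionalEquality using (_≡_; _≢_; refl; sym; trans; cong; cong₂)
  renaming (subst to transport)

-- Parameters and substitution

Below : ℕ → List ℕ → Set
Below n = All (_< n)

below-mono : ∀ {m n xs} → m ≤ n → Below m xs → Below n xs
below-mono m≤n = All.map (λ a<m → <-≤-trans a<m m≤n)

below-fresh : ∀ {n xs} → Below n xs → ¬ (n ∈ xs)
below-fresh below n∈xs = <-irrefl refl (All.lookup below n∈xs)

below-max : ∀ xs → Below (suc (max 0 xs)) xs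
below-max xs = All.map s≤s (xs≤max 0 xs)

parsTm : Term → List ℕ
parsTm t = parsT (tm t)

ClosedBelow : ℕ → Formula → Set
ClosedBelow n A = Closed A × Below n (pars A)

psubstT : (ℕ → Term) → Term → Term
psubstT σ (con c) = con c
psubstT σ (par a) = σ a

psubstFT : (ℕ → Term) → FTerm → FTerm
psubstFT σ (bv i) = bv i
psubstFT σ (tm t) = tm (psubstT σ t)

psubst : (ℕ → Term) → Formula → Formula
psubst σ (rel n ts) = rel n (map (psubstFT σ) ts)
psubst σ (E! s)     = E! (psubstFT σ s)
psubst σ (s ≐ r)    = psubstFT σ s ≐ psubstFT σ r
psubst σ ⊥'         = ⊥'
psubst σ (A ∧' B)   = psubst σ A ∧' psubst σ B
psubst σ (A ∨' B)   = psubst σ A ∨' psubst σ B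
psubst σ (A ⇒' B)   = psubst σ A ⇒' psubst σ B
psubst σ (A ⇔' B)   = psubst σ A ⇔' psubst σ B
psubst σ (∀' A)     = ∀' (psubst σ A)
psubst σ (∃' A)     = ∃' (psubst σ A)

psubstFT-substT : ∀ σ k t s → psubstFT σ (substT k t s) ≡ substT k (psubstT σ t) (psubstFT σ s)
psubstFT-substT σ k t (bv i) with i ≡ᵇ k
... | true  = refl
... | false = refl
psubstFT-substT σ k t (tm u) = refl

psubst-subst : ∀ σ k t A → psubst σ (subst k t A) ≡ subst k (psubstT σ t) (psubst σ A)
psubst-subst σ k t (rel n ts) =
  cong (rel n) (trans (sym (map-∘ ts)) (trans (map-cong (psubstFT-substT σ k t) ts) (map-∘ ts)))
psubst-subst σ k t (E! s)   = cong E! (psubstFT-substT σ k t s)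
psubst-subst σ k t (s ≐ r)  = cong₂ _≐_ (psubstFT-substT σ k t s) (psubstFT-substT σ k t r)
psubst-subst σ k t ⊥'       = refl
psubst-subst σ k t (A ∧' B) = cong₂ _∧'_ (psubst-subst σ k t A) (psubst-subst σ k t B)
psubst-subst σ k t (A ∨' B) = cong₂ _∨'_ (psubst-subst σ k t A) (psubst-subst σ k t B)
psubst-subst σ k t (A ⇒' B) = cong₂ _⇒'_ (psubst-subst σ k t A) (psubst-subst σ k t B)
psubst-subst σ k t (A ⇔' B) = cong₂ _⇔'_ (psubst-subst σ k t A) (psubst-subst σ k t B)
psubst-subst σ k t (∀' A)   = cong ∀' (psubst-subst σ (suc k) t A)
psubst-subst σ k t (∃' A)   = cong ∃' (psubst-subst σ (suc k) t A)

Agree : (σ τ : ℕ → Term) → List ℕ → Set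
Agree σ τ = All (λ a → σ a ≡ τ a)

psubstFT-cong : ∀ {σ τ} s → Agree σ τ (parsT s) → psubstFT σ s ≡ psubstFT τ s
psubstFT-cong (bv i)       _           = refl
psubstFT-cong (tm (con c)) _           = refl
psubstFT-cong (tm (par a)) (σa≡τa ∷ _) = cong tm σa≡τa

psubstFTs-cong : ∀ {σ τ} ts → Agree σ τ (parsL ts) → map (psubstFT σ) ts ≡ map (psubstFT τ) ts
psubstFTs-cong []       _  = refl
psubstFTs-cong (s ∷ ts) ag = cong₂ _∷_ (psubstFT-cong s (++⁻ˡ (parsT s) ag)) (psubstFTs-cong ts (++⁻ʳ (parsT s) ag))

psubst-cong : ∀ {σ τ} A → Agree σ τ (pars A) → psubst σ A ≡ psubst τ A
psubst-cong (rel n ts) ag = cong (rel n) (psubstFTs-cong ts ag)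
psubst-cong (E! s)     ag = cong E! (psubstFT-cong s ag)
psubst-cong (s ≐ r)    ag = cong₂ _≐_ (psubstFT-cong s (++⁻ˡ (parsT s) ag)) (psubstFT-cong r (++⁻ʳ (parsT s) ag))
psubst-cong ⊥'         ag = refl
psubst-cong (A ∧' B)   ag = cong₂ _∧'_ (psubst-cong A (++⁻ˡ (pars A) ag)) (psubst-cong B (++⁻ʳ (pars A) ag))
psubst-cong (A ∨' B)   ag = cong₂ _∨'_ (psubst-cong A (++⁻ˡ (pars A) ag)) (psubst-cong B (++⁻ʳ (pars A) ag))
psubst-cong (A ⇒' B)   ag = cong₂ _⇒'_ (psubst-cong A (++⁻ˡ (pars A) ag)) (psubst-cong B (++⁻ʳ (pars A) ag))
psubst-cong (A ⇔' B)   ag = cong₂ _⇔'_ (psubst-cong A (++⁻ˡ (pars A) ag)) (psubst-cong B (++⁻ʳ (pars A) ag))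
psubst-cong (∀' A)     ag = cong ∀' (psubst-cong A ag)
psubst-cong (∃' A)     ag = cong ∃' (psubst-cong A ag)

psubstFT-id : ∀ s → psubstFT par s ≡ s
psubstFT-id (bv i)       = refl
psubstFT-id (tm (con c)) = refl
psubstFT-id (tm (par a)) = refl

psubst-id : ∀ A → psubst par A ≡ A
psubst-id (rel n ts) = cong (rel n) (trans (map-cong psubstFT-id ts) (map-id ts))
psubst-id (E! s)     = cong E! (psubstFT-id s)
psubst-id (s ≐ r)    = cong₂ _≐_ (psubstFT-id s) (psubstFT-id r)
psubst-id ⊥'         = refl
psubst-id (A ∧' B)   = cong₂ _∧'_ (psubst-id A) (psubst-id B)
psubst-id (A ∨' B)   = cong₂ _∨'_ (psubst-id A) (psubst-id B)
psubst-id (A ⇒' B)   = cong₂ _⇒'_ (psubst-id A) (psubst-id B)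
psubst-id (A ⇔' B)   = cong₂ _⇔'_ (psubst-id A) (psubst-id B)
psubst-id (∀' A)     = cong ∀' (psubst-id A)
psubst-id (∃' A)     = cong ∃' (psubst-id A)

BelowSubst : ℕ → (ℕ → Term) → Set
BelowSubst n σ = ∀ a → Below n (parsTm (σ a))

psubstT-below : ∀ {n σ} → BelowSubst n σ → ∀ t → Below n (parsTm (psubstT σ t))
psubstT-below below (con c) = []
psubstT-below below (par a) = below a

psubstFT-below : ∀ {n σ} → BelowSubst n σ → ∀ s → Below n (parsT (psubstFT σ s))
psubstFT-below below (bv i) = []
psubstFT-below below (tm t) = psubstT-below below t

psubstFTs-below : ∀ {n σ} → BelowSubst n σ → ∀ ts → Below n (parsL (map (psubstFT σ) ts))
psubstFTs-below below []       = []
psubstFTs-below below (s ∷ ts) = ++⁺ (psubstFT-below below s) (psubstFTs-below below ts)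

psubst-below : ∀ {n σ} → BelowSubst n σ → ∀ A → Below n (pars (psubst σ A))
psubst-below below (rel n ts) = psubstFTs-below below ts
psubst-below below (E! s)     = psubstFT-below below s
psubst-below below (s ≐ r)    = ++⁺ (psubstFT-below below s) (psubstFT-below below r)
psubst-below below ⊥'         = []
psubst-below below (A ∧' B)   = ++⁺ (psubst-below below A) (psubst-below below B)
psubst-below below (A ∨' B)   = ++⁺ (psubst-below below A) (psubst-below below B)
psubst-below below (A ⇒' B)   = ++⁺ (psubst-below below A) (psubst-below below B)
psubst-below below (A ⇔' B)   = ++⁺ (psubst-below below A) (psubst-below below B)
psubst-below below (∀' A)     = psubst-below below A
psubst-below below (∃' A)     = psubst-below below A

substT-below : ∀ {n t} → Below n (parsTm t) → ∀ k s → Below n (parsT s) → Below n (parsT (substT k t s))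
substT-below bt k (bv i) bs with i ≡ᵇ k
... | true  = bt
... | false = bs
substT-below bt k (tm u) bs = bs

substTs-below : ∀ {n t} → Below n (parsTm t) → ∀ k ts → Below n (parsL ts) → Below n (parsL (map (substT k t) ts))
substTs-below bt k []       bs = []
substTs-below bt k (s ∷ ts) bs =
  ++⁺ (substT-below bt k s (++⁻ˡ (parsT s) bs)) (substTs-below bt k ts (++⁻ʳ (parsT s) bs))

subst-below : ∀ {n t} → Below n (parsTm t) → ∀ k A → Below n (pars A) → Below n (pars (subst k t A))
subst-below bt k (rel m ts) b = substTs-below bt k ts b
subst-below bt k (E! s)     b = substT-below bt k s b
subst-below bt k (s ≐ r)    b = ++⁺ (substT-below bt k s (++⁻ˡ (parsT s) b)) (substT-below bt k r (++⁻ʳ (parsT s) b))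
subst-below bt k ⊥'         b = []
subst-below bt k (A ∧' B)   b = ++⁺ (subst-below bt k A (++⁻ˡ (pars A) b)) (subst-below bt k B (++⁻ʳ (pars A) b))
subst-below bt k (A ∨' B)   b = ++⁺ (subst-below bt k A (++⁻ˡ (pars A) b)) (subst-below bt k B (++⁻ʳ (pars A) b))
subst-below bt k (A ⇒' B)   b = ++⁺ (subst-below bt k A (++⁻ˡ (pars A) b)) (subst-below bt k B (++⁻ʳ (pars A) b))
subst-below bt k (A ⇔' B)   b = ++⁺ (subst-below bt k A (++⁻ˡ (pars A) b)) (subst-below bt k B (++⁻ʳ (pars A) b))
subst-below bt k (∀' A)     b = subst-below bt (suc k) A b
subst-below bt k (∃' A)     b = subst-below bt (suc k) A b

wfT-subst : ∀ k t {s} → WFT (suc k) s → WFT k (substT k t s)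
wfT-subst k t {bv i} i<1+k with i ≡ᵇ k in i≡ᵇk
... | true  = tt
... | false = ≤∧≢⇒< (≤-pred i<1+k) (λ i≡k → transport T i≡ᵇk (≡⇒≡ᵇ i k i≡k))
wfT-subst k t {tm u} _ = tt

wf-subst : ∀ k t A → WF (suc k) A → WF k (subst k t A)
wf-subst k t (rel n ts) w       = map⁺ (All.map (wfT-subst k t) w)
wf-subst k t (E! s)     w       = wfT-subst k t w
wf-subst k t (s ≐ r)    (w , v) = wfT-subst k t w , wfT-subst k t v
wf-subst k t ⊥'         w       = tt
wf-subst k t (A ∧' B)   (w , v) = wf-subst k t A w , wf-subst k t B v
wf-subst k t (A ∨' B)   (w , v) = wf-subst k t A w , wf-subst k t B v
wf-subst k t (A ⇒' B)   (w , v) = wf-subst k t A w , wf-subst k t B v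
wf-subst k t (A ⇔' B)   (w , v) = wf-subst k t A w , wf-subst k t B v
wf-subst k t (∀' A)     w       = wf-subst (suc k) t A w
wf-subst k t (∃' A)     w       = wf-subst (suc k) t A w

wfT-psubst : ∀ σ k {s} → WFT k s → WFT k (psubstFT σ s)
wfT-psubst σ k {bv i} w = w
wfT-psubst σ k {tm u} w = tt

wf-psubst : ∀ σ k A → WF k A → WF k (psubst σ A)
wf-psubst σ k (rel n ts) w       = map⁺ (All.map (wfT-psubst σ k) w)
wf-psubst σ k (E! s)     w       = wfT-psubst σ k w
wf-psubst σ k (s ≐ r)    (w , v) = wfT-psubst σ k w , wfT-psubst σ k v
wf-psubst σ k ⊥'         w       = tt
wf-psubst σ k (A ∧' B)   (w , v) = wf-psubst σ k A w , wf-psubst σ k B v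
wf-psubst σ k (A ∨' B)   (w , v) = wf-psubst σ k A w , wf-psubst σ k B v
wf-psubst σ k (A ⇒' B)   (w , v) = wf-psubst σ k A w , wf-psubst σ k B v
wf-psubst σ k (A ⇔' B)   (w , v) = wf-psubst σ k A w , wf-psubst σ k B v
wf-psubst σ k (∀' A)     w       = wf-psubst σ (suc k) A w
wf-psubst σ k (∃' A)     w       = wf-psubst σ (suc k) A w

closedBelow-mono : ∀ {m n} A → m ≤ n → ClosedBelow m A → ClosedBelow n A
closedBelow-mono _ m≤n (cl , b) = cl , below-mono m≤n b

closedBelow-split : ∀ {n} A B → (Closed A × Closed B) × Below n (pars A ++ pars B)
                    → ClosedBelow n A × ClosedBelow n B
closedBelow-split A B ((clA , clB) , b) = (clA , ++⁻ˡ (pars A) b) , (clB , ++⁻ʳ (pars A) b)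

closedBelow-instance : ∀ {n t} A → Below n (parsTm t) → WF 1 A × Below n (pars A) → ClosedBelow n (A [ t ])
closedBelow-instance {t = t} A bt (wf , b) = wf-subst 0 t A wf , subst-below bt 0 A b

atomic-psubst : ∀ σ {A} → Atomic A → Atomic (psubst σ A)
atomic-psubst σ (rel n ts) = rel n _
atomic-psubst σ (E! t)     = E! _
atomic-psubst σ (eq s t)   = eq _ _

atomic-subst : ∀ k t {A} → Atomic A → Atomic (subst k t A)
atomic-subst k t (rel n ts) = rel n _
atomic-subst k t (E! s)     = E! _
atomic-subst k t (eq s r)   = eq _ _

-- Instantiating a bound variable preserves the shape, so the semantics
-- recurses on shapes: A [ t ] is not a subformula of ∀' A.
data Shape : Set where
  base           : Shape
  and or imp iff : Shape → Shape → Shape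
  all ex         : Shape → Shape

shape : Formula → Shape
shape (rel n ts) = base
shape (E! s)     = base
shape (s ≐ r)    = base
shape ⊥'         = base
shape (A ∧' B)   = and (shape A) (shape B)
shape (A ∨' B)   = or  (shape A) (shape B)
shape (A ⇒' B)   = imp (shape A) (shape B)
shape (A ⇔' B)   = iff (shape A) (shape B)
shape (∀' A)     = all (shape A)
shape (∃' A)     = ex  (shape A)

shape-subst : ∀ k t A → shape (subst k t A) ≡ shape A
shape-subst k t (rel n ts) = refl
shape-subst k t (E! s)     = refl
shape-subst k t (s ≐ r)    = refl
shape-subst k t ⊥'         = refl
shape-subst k t (A ∧' B)   = cong₂ and (shape-subst k t A) (shape-subst k t B)
shape-subst k t (A ∨' B)   = cong₂ or  (shape-subst k t A) (shape-subst k t B)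
shape-subst k t (A ⇒' B)   = cong₂ imp (shape-subst k t A) (shape-subst k t B)
shape-subst k t (A ⇔' B)   = cong₂ iff (shape-subst k t A) (shape-subst k t B)
shape-subst k t (∀' A)     = cong all (shape-subst (suc k) t A)
shape-subst k t (∃' A)     = cong ex  (shape-subst (suc k) t A)

-- Decidable equality of formulas

data Tree : Set where
  node : ℕ → List Tree → Tree

infix 4 _≟Tree_ _≟Trees_

_≟Tree_  : (x y : Tree) → Dec (x ≡ y)
_≟Trees_ : (xs ys : List Tree) → Dec (xs ≡ ys)
node m xs ≟Tree node n ys with m ℕ.≟ n | xs ≟Trees ys
... | yes refl | yes refl = yes refl
... | no m≢n   | _        = no λ { refl → m≢n refl }
... | yes _    | no xs≢ys = no λ { refl → xs≢ys refl }
[]       ≟Trees []       = yes refl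
[]       ≟Trees (_ ∷ _)  = no λ ()
(_ ∷ _)  ≟Trees []       = no λ ()
(x ∷ xs) ≟Trees (y ∷ ys) with x ≟Tree y | xs ≟Trees ys
... | yes refl | yes refl = yes refl
... | no x≢y   | _        = no λ { refl → x≢y refl }
... | yes _    | no xs≢ys = no λ { refl → xs≢ys refl }

encodeFT : FTerm → Tree
encodeFT (bv i)       = node 0 (node i [] ∷ [])
encodeFT (tm (con c)) = node 1 (node c [] ∷ [])
encodeFT (tm (par a)) = node 2 (node a [] ∷ [])

decodeFT : Tree → FTerm
decodeFT (node 1 (node c _ ∷ _)) = tm (con c)
decodeFT (node 2 (node a _ ∷ _)) = tm (par a)
decodeFT (node _ (node i _ ∷ _)) = bv i
decodeFT (node _ [])             = bv 0

encode : Formula → Tree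
encode (rel n ts) = node 0 (node n [] ∷ map encodeFT ts)
encode (E! s)     = node 1 (encodeFT s ∷ [])
encode (s ≐ r)    = node 2 (encodeFT s ∷ encodeFT r ∷ [])
encode ⊥'         = node 3 []
encode (A ∧' B)   = node 4 (encode A ∷ encode B ∷ [])
encode (A ∨' B)   = node 5 (encode A ∷ encode B ∷ [])
encode (A ⇒' B)   = node 6 (encode A ∷ encode B ∷ [])
encode (A ⇔' B)   = node 7 (encode A ∷ encode B ∷ [])
encode (∀' A)     = node 8 (encode A ∷ [])
encode (∃' A)     = node 9 (encode A ∷ [])

decode : Tree → Formula
decode (node 0 (node n _ ∷ xs))  = rel n (map decodeFT xs)
decode (node 1 (x ∷ _))          = E! (decodeFT x)
decode (node 2 (x ∷ y ∷ _))      = decodeFT x ≐ decodeFT y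
decode (node 4 (x ∷ y ∷ _))      = decode x ∧' decode y
decode (node 5 (x ∷ y ∷ _))      = decode x ∨' decode y
decode (node 6 (x ∷ y ∷ _))      = decode x ⇒' decode y
decode (node 7 (x ∷ y ∷ _))      = decode x ⇔' decode y
decode (node 8 (x ∷ _))          = ∀' (decode x)
decode (node 9 (x ∷ _))          = ∃' (decode x)
decode _                         = ⊥'

decodeFT-encodeFT : ∀ s → decodeFT (encodeFT s) ≡ s
decodeFT-encodeFT (bv i)       = refl
decodeFT-encodeFT (tm (con c)) = refl
decodeFT-encodeFT (tm (par a)) = refl

decode-encode : ∀ A → decode (encode A) ≡ A
decode-encode (rel n ts) = cong (rel n) (trans (sym (map-∘ ts)) (trans (map-cong decodeFT-encodeFT ts) (map-id ts)))
decode-encode (E! s)     = cong E! (decodeFT-encodeFT s)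
decode-encode (s ≐ r)    = cong₂ _≐_ (decodeFT-encodeFT s) (decodeFT-encodeFT r)
decode-encode ⊥'         = refl
decode-encode (A ∧' B)   = cong₂ _∧'_ (decode-encode A) (decode-encode B)
decode-encode (A ∨' B)   = cong₂ _∨'_ (decode-encode A) (decode-encode B)
decode-encode (A ⇒' B)   = cong₂ _⇒'_ (decode-encode A) (decode-encode B)
decode-encode (A ⇔' B)   = cong₂ _⇔'_ (decode-encode A) (decode-encode B)
decode-encode (∀' A)     = cong ∀' (decode-encode A)
decode-encode (∃' A)     = cong ∃' (decode-encode A)

infix 4 _≟F_ _≟Tm_ _≟Ass_

_≟F_ : (A B : Formula) → Dec (A ≡ B)
A ≟F B with encode A ≟Tree encode B
... | yes eA≡eB = yes (trans (sym (decode-encode A)) (trans (cong decode eA≡eB) (decode-encode B)))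
... | no  eA≢eB = no (eA≢eB ∘ cong encode)

_≟Tm_ : (s t : Term) → Dec (s ≡ t)
con m ≟Tm con n with m ℕ.≟ n
... | yes refl = yes refl
... | no m≢n   = no λ { refl → m≢n refl }
par m ≟Tm par n with m ℕ.≟ n
... | yes refl = yes refl
... | no m≢n   = no λ { refl → m≢n refl }
con _ ≟Tm par _ = no λ ()
par _ ≟Tm con _ = no λ ()

_≟Ass_ : (p q : Label × Formula) → Dec (p ≡ q)
_≟Ass_ = ≡-dec ℕ._≟_ _≟F_

-- Open assumptions and normal deductions

Assumption : Set
Assumption = Label × Formula

closed-conclusion : ∀ {C} {d : Der C} → IsDed d → Closed C
closed-conclusion (ass c)            = c
closed-conclusion (∧I c _ _)         = c
closed-conclusion (∧E₁ c _)          = c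
closed-conclusion (∧E₂ c _)          = c
closed-conclusion (⇒I c _)           = c
closed-conclusion (⇒E c _ _)         = c
closed-conclusion (∨I₁ c _)          = c
closed-conclusion (∨I₂ c _)          = c
closed-conclusion (∨E c _ _ _)       = c
closed-conclusion (⇔I c _ _)         = c
closed-conclusion (⇔E₁ c _ _)        = c
closed-conclusion (⇔E₂ c _ _)        = c
closed-conclusion (⊥E c _ _)         = c
closed-conclusion (allI c _ _ _)     = c
closed-conclusion (allE c _ _)       = c
closed-conclusion (exI c _ _)        = c
closed-conclusion (exE c _ _ _ _ _)  = c
closed-conclusion ≐I                 = tt , tt
closed-conclusion (≐E c _ _ _ _)     = c

closed-assumption : ∀ {C} {d : Der C} {u B} → IsDed d → (u , B) ∈ass d → Closed B
closed-assumption (ass c)              ass           = c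
closed-assumption (∧I _ dd _)          (∧I₁ p)       = closed-assumption dd p
closed-assumption (∧I _ _ ed)          (∧I₂ p)       = closed-assumption ed p
closed-assumption (∧E₁ _ dd)           (∧E₁ p)       = closed-assumption dd p
closed-assumption (∧E₂ _ dd)           (∧E₂ p)       = closed-assumption dd p
closed-assumption (⇒I _ dd)            (⇒I p _)      = closed-assumption dd p
closed-assumption (⇒E _ dd _)          (⇒E₁ p)       = closed-assumption dd p
closed-assumption (⇒E _ _ ed)          (⇒E₂ p)       = closed-assumption ed p
closed-assumption (∨I₁ _ dd)           (∨I₁ p)       = closed-assumption dd p
closed-assumption (∨I₂ _ dd)           (∨I₂ p)       = closed-assumption dd p
closed-assumption (∨E _ dd _ _)        (∨E₀ p)       = closed-assumption dd p
closed-assumption (∨E _ _ ed _)        (∨E₁ p _)     = closed-assumption ed p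
closed-assumption (∨E _ _ _ fd)        (∨E₂ p _)     = closed-assumption fd p
closed-assumption (⇔I _ dd _)          (⇔I₁ p _)     = closed-assumption dd p
closed-assumption (⇔I _ _ ed)          (⇔I₂ p _)     = closed-assumption ed p
closed-assumption (⇔E₁ _ dd _)         (⇔E₁₁ p)      = closed-assumption dd p
closed-assumption (⇔E₁ _ _ ed)         (⇔E₁₂ p)      = closed-assumption ed p
closed-assumption (⇔E₂ _ dd _)         (⇔E₂₁ p)      = closed-assumption dd p
closed-assumption (⇔E₂ _ _ ed)         (⇔E₂₂ p)      = closed-assumption ed p
closed-assumption (⊥E _ _ dd)          (⊥E p)        = closed-assumption dd p
closed-assumption (allI _ _ _ dd)      (allI p _)    = closed-assumption dd p
closed-assumption (allE _ dd _)        (allE₁ p)     = closed-assumption dd p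
closed-assumption (allE _ _ ed)        (allE₂ p)     = closed-assumption ed p
closed-assumption (exI _ dd _)         (exI₁ p)      = closed-assumption dd p
closed-assumption (exI _ _ ed)         (exI₂ p)      = closed-assumption ed p
closed-assumption (exE _ _ _ _ dd _)   (exE₀ p)      = closed-assumption dd p
closed-assumption (exE _ _ _ _ _ ed)   (exE₁ p _ _)  = closed-assumption ed p
closed-assumption (≐E _ _ _ dd _)      (≐E₁ p)       = closed-assumption dd p
closed-assumption (≐E _ _ _ _ ed)      (≐E₂ p)       = closed-assumption ed p

_without_ : List Assumption → Assumption → List Assumption
ps without p = filter (λ q → ¬? (q ≟Ass p)) ps

∈-without⁺ : ∀ {p q ps} → q ∈ ps → q ≢ p → q ∈ ps without p
∈-without⁺ = ∈-filter⁺ (λ q → ¬? (q ≟Ass _))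

∈-without⁻ : ∀ {p q} ps → q ∈ ps without p → q ∈ ps × q ≢ p
∈-without⁻ _ = ∈-filter⁻ (λ q → ¬? (q ≟Ass _))

opens : ∀ {C} → Der C → List Assumption
opens (ass u A)               = (u , A) ∷ []
opens (∧I d e)                = opens d ++ opens e
opens (∧E₁ d)                 = opens d
opens (∧E₂ d)                 = opens d
opens (⇒I u A d)              = opens d without (u , A)
opens (⇒E d e)                = opens d ++ opens e
opens (∨I₁ B d)               = opens d
opens (∨I₂ A d)               = opens d
opens (∨E {A} {B} u v d e f)  = opens d ++ (opens e without (u , A) ++ opens f without (v , B))
opens (⇔I u v A B d e)        = opens d without (u , A) ++ opens e without (v , B)
opens (⇔E₁ d e)               = opens d ++ opens e
opens (⇔E₂ d e)               = opens d ++ opens e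
opens (⊥E A d)                = opens d
opens (allI u a d)            = opens d without (u , E! (tm (par a)))
opens (allE t d e)            = opens d ++ opens e
opens (exI A t d e)           = opens d ++ opens e
opens (exE {A} u v a d e)     = opens d ++ (opens e without (v , E! (tm (par a)))) without (u , A [ par a ])
opens (≐I t)                  = []
opens (≐E A t₁ t₂ d e)        = opens d ++ opens e

∈ass⇒∈opens : ∀ {C} {d : Der C} {p} → p ∈ass d → p ∈ opens d
∈ass⇒∈opens ass                                     = here refl
∈ass⇒∈opens (∧I₁ p)                                 = ∈-++⁺ˡ (∈ass⇒∈opens p)
∈ass⇒∈opens {d = ∧I d _} (∧I₂ p)                    = ∈-++⁺ʳ (opens d) (∈ass⇒∈opens p)
∈ass⇒∈opens (∧E₁ p)                                 = ∈ass⇒∈opens p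
∈ass⇒∈opens (∧E₂ p)                                 = ∈ass⇒∈opens p
∈ass⇒∈opens (⇒I p p≢)                               = ∈-without⁺ (∈ass⇒∈opens p) p≢
∈ass⇒∈opens (⇒E₁ p)                                 = ∈-++⁺ˡ (∈ass⇒∈opens p)
∈ass⇒∈opens {d = ⇒E d _} (⇒E₂ p)                    = ∈-++⁺ʳ (opens d) (∈ass⇒∈opens p)
∈ass⇒∈opens (∨I₁ p)                                 = ∈ass⇒∈opens p
∈ass⇒∈opens (∨I₂ p)                                 = ∈ass⇒∈opens p
∈ass⇒∈opens (∨E₀ p)                                 = ∈-++⁺ˡ (∈ass⇒∈opens p)
∈ass⇒∈opens {d = ∨E _ _ d _ _} (∨E₁ p p≢)           =
  ∈-++⁺ʳ (opens d) (∈-++⁺ˡ (∈-without⁺ (∈ass⇒∈opens p) p≢))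
∈ass⇒∈opens {d = ∨E {A} u _ d e _} (∨E₂ p p≢)       =
  ∈-++⁺ʳ (opens d) (∈-++⁺ʳ (opens e without (u , A)) (∈-without⁺ (∈ass⇒∈opens p) p≢))
∈ass⇒∈opens (⇔I₁ p p≢)                              = ∈-++⁺ˡ (∈-without⁺ (∈ass⇒∈opens p) p≢)
∈ass⇒∈opens {d = ⇔I u _ A _ d _} (⇔I₂ p p≢)         =
  ∈-++⁺ʳ (opens d without (u , A)) (∈-without⁺ (∈ass⇒∈opens p) p≢)
∈ass⇒∈opens (⇔E₁₁ p)                                = ∈-++⁺ˡ (∈ass⇒∈opens p)
∈ass⇒∈opens {d = ⇔E₁ d _} (⇔E₁₂ p)                  = ∈-++⁺ʳ (opens d) (∈ass⇒∈opens p)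
∈ass⇒∈opens (⇔E₂₁ p)                                = ∈-++⁺ˡ (∈ass⇒∈opens p)
∈ass⇒∈opens {d = ⇔E₂ d _} (⇔E₂₂ p)                  = ∈-++⁺ʳ (opens d) (∈ass⇒∈opens p)
∈ass⇒∈opens (⊥E p)                                  = ∈ass⇒∈opens p
∈ass⇒∈opens (allI p p≢)                             = ∈-without⁺ (∈ass⇒∈opens p) p≢
∈ass⇒∈opens (allE₁ p)                               = ∈-++⁺ˡ (∈ass⇒∈opens p)
∈ass⇒∈opens {d = allE _ d _} (allE₂ p)              = ∈-++⁺ʳ (opens d) (∈ass⇒∈opens p)
∈ass⇒∈opens (exI₁ p)                                = ∈-++⁺ˡ (∈ass⇒∈opens p)
∈ass⇒∈opens {d = exI _ _ d _} (exI₂ p)              = ∈-++⁺ʳ (opens d) (∈ass⇒∈opens p)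
∈ass⇒∈opens (exE₀ p)                                = ∈-++⁺ˡ (∈ass⇒∈opens p)
∈ass⇒∈opens {d = exE _ _ _ d _} (exE₁ p p≢₁ p≢₂)    =
  ∈-++⁺ʳ (opens d) (∈-without⁺ (∈-without⁺ (∈ass⇒∈opens p) p≢₂) p≢₁)
∈ass⇒∈opens (≐E₁ p)                                 = ∈-++⁺ˡ (∈ass⇒∈opens p)
∈ass⇒∈opens {d = ≐E _ _ _ d _} (≐E₂ p)              = ∈-++⁺ʳ (opens d) (∈ass⇒∈opens p)

∈opens⇒∈ass : ∀ {C} (d : Der C) {p} → p ∈ opens d → p ∈ass d
∈opens⇒∈ass (ass u A) (here refl) = ass
∈opens⇒∈ass (∧I d e) m with ∈-++⁻ (opens d) m
... | inj₁ m′ = ∧I₁ (∈opens⇒∈ass d m′)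
... | inj₂ m′ = ∧I₂ (∈opens⇒∈ass e m′)
∈opens⇒∈ass (∧E₁ d) m = ∧E₁ (∈opens⇒∈ass d m)
∈opens⇒∈ass (∧E₂ d) m = ∧E₂ (∈opens⇒∈ass d m)
∈opens⇒∈ass (⇒I u A d) m with ∈-without⁻ (opens d) m
... | m′ , p≢ = ⇒I (∈opens⇒∈ass d m′) p≢
∈opens⇒∈ass (⇒E d e) m with ∈-++⁻ (opens d) m
... | inj₁ m′ = ⇒E₁ (∈opens⇒∈ass d m′)
... | inj₂ m′ = ⇒E₂ (∈opens⇒∈ass e m′)
∈opens⇒∈ass (∨I₁ B d) m = ∨I₁ (∈opens⇒∈ass d m)
∈opens⇒∈ass (∨I₂ A d) m = ∨I₂ (∈opens⇒∈ass d m)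
∈opens⇒∈ass (∨E {A} u v d e f) m with ∈-++⁻ (opens d) m
... | inj₁ m′ = ∨E₀ (∈opens⇒∈ass d m′)
... | inj₂ m′ with ∈-++⁻ (opens e without (u , A)) m′
...   | inj₁ m″ = let m‴ , p≢ = ∈-without⁻ (opens e) m″ in ∨E₁ (∈opens⇒∈ass e m‴) p≢
...   | inj₂ m″ = let m‴ , p≢ = ∈-without⁻ (opens f) m″ in ∨E₂ (∈opens⇒∈ass f m‴) p≢
∈opens⇒∈ass (⇔I u v A B d e) m with ∈-++⁻ (opens d without (u , A)) m
... | inj₁ m′ = let m″ , p≢ = ∈-without⁻ (opens d) m′ in ⇔I₁ (∈opens⇒∈ass d m″) p≢
... | inj₂ m′ = let m″ , p≢ = ∈-without⁻ (opens e) m′ in ⇔I₂ (∈opens⇒∈ass e m″) p≢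
∈opens⇒∈ass (⇔E₁ d e) m with ∈-++⁻ (opens d) m
... | inj₁ m′ = ⇔E₁₁ (∈opens⇒∈ass d m′)
... | inj₂ m′ = ⇔E₁₂ (∈opens⇒∈ass e m′)
∈opens⇒∈ass (⇔E₂ d e) m with ∈-++⁻ (opens d) m
... | inj₁ m′ = ⇔E₂₁ (∈opens⇒∈ass d m′)
... | inj₂ m′ = ⇔E₂₂ (∈opens⇒∈ass e m′)
∈opens⇒∈ass (⊥E A d) m = ⊥E (∈opens⇒∈ass d m)
∈opens⇒∈ass (allI u a d) m with ∈-without⁻ (opens d) m
... | m′ , p≢ = allI (∈opens⇒∈ass d m′) p≢
∈opens⇒∈ass (allE t d e) m with ∈-++⁻ (opens d) m
... | inj₁ m′ = allE₁ (∈opens⇒∈ass d m′)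
... | inj₂ m′ = allE₂ (∈opens⇒∈ass e m′)
∈opens⇒∈ass (exI A t d e) m with ∈-++⁻ (opens d) m
... | inj₁ m′ = exI₁ (∈opens⇒∈ass d m′)
... | inj₂ m′ = exI₂ (∈opens⇒∈ass e m′)
∈opens⇒∈ass (exE u v a d e) m with ∈-++⁻ (opens d) m
... | inj₁ m′ = exE₀ (∈opens⇒∈ass d m′)
... | inj₂ m′ with ∈-without⁻ (opens e without _) m′
...   | m″ , p≢₁ with ∈-without⁻ (opens e) m″
...     | m‴ , p≢₂ = exE₁ (∈opens⇒∈ass e m‴) p≢₁ p≢₂
∈opens⇒∈ass (≐E A t₁ t₂ d e) m with ∈-++⁻ (opens d) m
... | inj₁ m′ = ≐E₁ (∈opens⇒∈ass d m′)
... | inj₂ m′ = ≐E₂ (∈opens⇒∈ass e m′)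

data Ne : ∀ {C} → Der C → Set
data Nf : ∀ {C} → Der C → Set

data Ne where
  ass  : ∀ {u A} → Ne (ass u A)
  ∧E₁  : ∀ {A B} {d : Der (A ∧' B)} → Ne d → Ne (∧E₁ d)
  ∧E₂  : ∀ {A B} {d : Der (A ∧' B)} → Ne d → Ne (∧E₂ d)
  ⇒E   : ∀ {A B} {d : Der (A ⇒' B)} {e : Der A} → Ne d → Nf e → Ne (⇒E d e)
  ⇔E₁  : ∀ {A B} {d : Der (A ⇔' B)} {e : Der A} → Ne d → Nf e → Ne (⇔E₁ d e)
  ⇔E₂  : ∀ {A B} {d : Der (A ⇔' B)} {e : Der B} → Ne d → Nf e → Ne (⇔E₂ d e)
  ⊥E   : ∀ {A} {d : Der ⊥'} → Ne d → Ne (⊥E A d)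
  allE : ∀ {A t} {d : Der (∀' A)} {e : Der (E! (tm t))} → Ne d → Nf e → Ne (allE t d e)
  ≐E   : ∀ {A t₁ t₂} {d : Der (tm t₁ ≐ tm t₂)} {e : Der (A [ t₁ ])} → Ne d → Nf e → Ne (≐E A t₁ t₂ d e)

data Nf where
  ne   : ∀ {C} {d : Der C} → Ne d → Nf d
  ∧I   : ∀ {A B} {d : Der A} {e : Der B} → Nf d → Nf e → Nf (∧I d e)
  ⇒I   : ∀ {B u A} {d : Der B} → Nf d → Nf (⇒I u A d)
  ∨I₁  : ∀ {A B} {d : Der A} → Nf d → Nf (∨I₁ B d)
  ∨I₂  : ∀ {A B} {d : Der B} → Nf d → Nf (∨I₂ A d)
  ⇔I   : ∀ {u v A B} {d : Der B} {e : Der A} → Nf d → Nf e → Nf (⇔I u v A B d e)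
  allI : ∀ {A u a} {d : Der (A [ par a ])} → Nf d → Nf (allI u a d)
  exI  : ∀ {A t} {d : Der (A [ t ])} {e : Der (E! (tm t))} → Nf d → Nf e → Nf (exI A t d e)
  ≐I   : ∀ {t} → Nf (≐I t)
  ∨E   : ∀ {u v A B C} {d : Der (A ∨' B)} {e f : Der C} → Ne d → Nf e → Nf f → Nf (∨E u v d e f)
  exE  : ∀ {u v a A C} {d : Der (∃' A)} {e : Der C} → Ne d → Nf e → Nf (exE u v a d e)

ne-not-intro : ∀ {C} {d : Der C} → Ne d → isIntro d ≡ false
ne-not-intro ass        = refl
ne-not-intro (∧E₁ _)    = refl
ne-not-intro (∧E₂ _)    = refl
ne-not-intro (⇒E _ _)   = refl
ne-not-intro (⇔E₁ _ _)  = refl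
ne-not-intro (⇔E₂ _ _)  = refl
ne-not-intro (⊥E _)     = refl
ne-not-intro (allE _ _) = refl
ne-not-intro (≐E _ _)   = refl

ne-not-del : ∀ {C} {d : Der C} → Ne d → isDel d ≡ false
ne-not-del ass        = refl
ne-not-del (∧E₁ _)    = refl
ne-not-del (∧E₂ _)    = refl
ne-not-del (⇒E _ _)   = refl
ne-not-del (⇔E₁ _ _)  = refl
ne-not-del (⇔E₂ _ _)  = refl
ne-not-del (⊥E _)     = refl
ne-not-del (allE _ _) = refl
ne-not-del (≐E _ _)   = refl

segUp-not-del : ∀ {C} {d : Der C} {n} → isDel d ≡ false → SegUp d n → n ≡ 1
segUp-not-del _  (start _) = refl
segUp-not-del () (∨E₁ _)
segUp-not-del () (∨E₂ _)
segUp-not-del () (exE _)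

major-ne : ∀ {C} {d : Der C} {m} → Ne d → major d ≡ just m → Ne (proj₂ m)
major-ne (∧E₁ n)    refl = n
major-ne (∧E₂ n)    refl = n
major-ne (⇒E n _)   refl = n
major-ne (⇔E₁ n _)  refl = n
major-ne (⇔E₂ n _)  refl = n
major-ne (⊥E n)     refl = n
major-ne (allE n _) refl = n
major-ne (≐E n _)   refl = n

major-nf : ∀ {C} {d : Der C} {m} → Nf d → major d ≡ just m → Ne (proj₂ m)
major-nf (ne n)     m≡   = major-ne n m≡
major-nf (∨E n _ _) refl = n
major-nf (exE n _)  refl = n

children-ne : ∀ {C} {d : Der C} {y} → Ne d → y ∈ children d → Nf (proj₂ y)
children-ne (∧E₁ n)    (here refl)         = ne n
children-ne (∧E₂ n)    (here refl)         = ne n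
children-ne (⇒E n _)   (here refl)         = ne n
children-ne (⇒E _ e)   (there (here refl)) = e
children-ne (⇔E₁ n _)  (here refl)         = ne n
children-ne (⇔E₁ _ e)  (there (here refl)) = e
children-ne (⇔E₂ n _)  (here refl)         = ne n
children-ne (⇔E₂ _ e)  (there (here refl)) = e
children-ne (⊥E n)     (here refl)         = ne n
children-ne (allE n _) (here refl)         = ne n
children-ne (allE _ e) (there (here refl)) = e
children-ne (≐E n _)   (here refl)         = ne n
children-ne (≐E _ e)   (there (here refl)) = e

children-nf : ∀ {C} {d : Der C} {y} → Nf d → y ∈ children d → Nf (proj₂ y)
children-nf (ne n)     m                           = children-ne n m
children-nf (∧I d _)   (here refl)                 = d
children-nf (∧I _ e)   (there (here refl))         = e
children-nf (⇒I d)     (here refl)                 = d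
children-nf (∨I₁ d)    (here refl)                 = d
children-nf (∨I₂ d)    (here refl)                 = d
children-nf (⇔I d _)   (here refl)                 = d
children-nf (⇔I _ e)   (there (here refl))         = e
children-nf (allI d)   (here refl)                 = d
children-nf (exI d _)  (here refl)                 = d
children-nf (exI _ e)  (there (here refl))         = e
children-nf (∨E n _ _) (here refl)                 = ne n
children-nf (∨E _ e _) (there (here refl))         = e
children-nf (∨E _ _ f) (there (there (here refl))) = f
children-nf (exE n _)  (here refl)                 = ne n
children-nf (exE _ e)  (there (here refl))         = e

nf-no-maximal-formula : ∀ {C} {d : Der C} → Nf d → ¬ MaximalFormulaAtRoot (C , d)
nf-no-maximal-formula nf (m , m≡ , intro) with () ← trans (sym intro) (ne-not-intro (major-nf nf m≡))

nf-no-maximal-segment : ∀ {C} {d : Der C} → Nf d → ¬ MaximalSegmentAtRoot (C , d)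
nf-no-maximal-segment nf (m , m≡ , n , 2≤n , seg)
  with refl ← segUp-not-del (ne-not-del (major-nf nf m≡)) seg
  with s≤s () ← 2≤n

nf⇒normal : ∀ {C} {d : Der C} → Nf d → Normal d
nf⇒normal nf x here                = nf-no-maximal-formula nf , nf-no-maximal-segment nf
nf⇒normal nf x (there y∈ch x≼y)    = nf⇒normal (children-nf nf y∈ch) x x≼y

-- Kripke worlds

-- No parameter of a hypothesis reaches fresh, which is therefore
-- available as the eigenparameter of ∀I and ∃E.
record World : Set where
  constructor world
  field
    hyps    : List Assumption
    fresh   : ℕ
    hyps-wf : All (ClosedBelow fresh ∘ proj₂) hyps
open World public

record _≤W_ (w w′ : World) : Set where
  constructor ≤W-intro
  field
    hyps-⊆  : hyps w ⊆ hyps w′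
    fresh-≤ : fresh w ≤ fresh w′
open _≤W_ public

≤W-refl : ∀ {w} → w ≤W w
≤W-refl = ≤W-intro (λ m → m) ≤-refl

≤W-trans : ∀ {w₁ w₂ w₃} → w₁ ≤W w₂ → w₂ ≤W w₃ → w₁ ≤W w₃
≤W-trans (≤W-intro ⊆₁ ≤₁) (≤W-intro ⊆₂ ≤₂) = ≤W-intro (⊆₂ ∘ ⊆₁) (≤-trans ≤₁ ≤₂)

-- All hypotheses are introduced with label 0.  Discharging (0 , A) then
-- also discharges outer occurrences of the same hypothesis, which only
-- shrinks the set of open assumptions.
assume : (w : World) (A : Formula) → ClosedBelow (fresh w) A → World
assume w A wfA = world ((0 , A) ∷ hyps w) (fresh w) (wfA ∷ hyps-wf w)

assume-≤ : ∀ {w A wfA} → w ≤W assume w A wfA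
assume-≤ = ≤W-intro there ≤-refl

newPar : World → World
newPar w = world ((0 , E! (tm (par (fresh w)))) ∷ hyps w) (suc (fresh w))
                 ((tt , ≤-refl ∷ []) ∷ All.map (λ {p} → closedBelow-mono (proj₂ p) (n≤1+n _)) (hyps-wf w))

newPar-≤ : ∀ {w} → w ≤W newPar w
newPar-≤ = ≤W-intro there (n≤1+n _)

witness : (w : World) (A : Formula) → ClosedBelow (fresh w) (∃' A) → World
witness w A wfA = assume (newPar w) (A [ par (fresh w) ])
                         (closedBelow-instance A (≤-refl ∷ []) (closedBelow-mono (∃' A) (n≤1+n _) wfA))

witness-≤ : ∀ {w A wfA} → w ≤W witness w A wfA
witness-≤ = ≤W-trans newPar-≤ assume-≤

fresh-∉-hyps : ∀ {w p} → p ∈ hyps w → ¬ (fresh w occursIn proj₂ p)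
fresh-∉-hyps {w} h = below-fresh (proj₂ (All.lookup (hyps-wf w) h))

OpenIn : ∀ {C} → List Assumption → Der C → Set
OpenIn Γ d = ∀ {p} → p ∈ass d → p ∈ Γ

∈-∷-≢ : ∀ {p q : Assumption} {Γ} → p ∈ q ∷ Γ → p ≢ q → p ∈ Γ
∈-∷-≢ (here p≡q) p≢q = ⊥-elim (p≢q p≡q)
∈-∷-≢ (there p∈Γ) _  = p∈Γ

record NE (w : World) (C : Formula) : Set where
  constructor neutral
  field
    der   : Der C
    isDed : IsDed der
    isNe  : Ne der
    open⊆ : OpenIn (hyps w) der
    wf    : ClosedBelow (fresh w) C

record NF (w : World) (C : Formula) : Set where
  constructor normal
  field
    der   : Der C
    isDed : IsDed der
    isNf  : Nf der
    open⊆ : OpenIn (hyps w) der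

ne-mono : ∀ {w w′ C} → w ≤W w′ → NE w C → NE w′ C
ne-mono {C = C} w≤w′ (neutral d dd dn op wf) =
  neutral d dd dn (hyps-⊆ w≤w′ ∘ op) (closedBelow-mono C (fresh-≤ w≤w′) wf)

ne⇒nf : ∀ {w C} → NE w C → NF w C
ne⇒nf (neutral d dd dn op _) = normal d dd (ne dn) op

ne-hyp : ∀ {w u A} → (u , A) ∈ hyps w → NE w A
ne-hyp {w} {u} {A} h = neutral (ass u A) (ass (proj₁ wfA)) ass (λ { ass → h }) wfA
  where wfA = All.lookup (hyps-wf w) h

ne-∧E₁ : ∀ {w A B} → NE w (A ∧' B) → NE w A
ne-∧E₁ {A = A} {B} (neutral d dd dn op wf) =
  let wfA , _ = closedBelow-split A B wf in
  neutral (∧E₁ d) (∧E₁ (proj₁ wfA) dd) (∧E₁ dn) (λ { (∧E₁ p) → op p }) wfA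

ne-∧E₂ : ∀ {w A B} → NE w (A ∧' B) → NE w B
ne-∧E₂ {A = A} {B} (neutral d dd dn op wf) =
  let _ , wfB = closedBelow-split A B wf in
  neutral (∧E₂ d) (∧E₂ (proj₁ wfB) dd) (∧E₂ dn) (λ { (∧E₂ p) → op p }) wfB

ne-⇒E : ∀ {w A B} → NE w (A ⇒' B) → NF w A → NE w B
ne-⇒E {A = A} {B} (neutral d dd dn op wf) (normal e ed en eop) =
  let _ , wfB = closedBelow-split A B wf in
  neutral (⇒E d e) (⇒E (proj₁ wfB) dd ed) (⇒E dn en)
          (λ { (⇒E₁ p) → op p ; (⇒E₂ p) → eop p }) wfB

ne-⇔E₁ : ∀ {w A B} → NE w (A ⇔' B) → NF w A → NE w B
ne-⇔E₁ {A = A} {B} (neutral d dd dn op wf) (normal e ed en eop) =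
  let _ , wfB = closedBelow-split A B wf in
  neutral (⇔E₁ d e) (⇔E₁ (proj₁ wfB) dd ed) (⇔E₁ dn en)
          (λ { (⇔E₁₁ p) → op p ; (⇔E₁₂ p) → eop p }) wfB

ne-⇔E₂ : ∀ {w A B} → NE w (A ⇔' B) → NF w B → NE w A
ne-⇔E₂ {A = A} {B} (neutral d dd dn op wf) (normal e ed en eop) =
  let wfA , _ = closedBelow-split A B wf in
  neutral (⇔E₂ d e) (⇔E₂ (proj₁ wfA) dd ed) (⇔E₂ dn en)
          (λ { (⇔E₂₁ p) → op p ; (⇔E₂₂ p) → eop p }) wfA

ne-allE : ∀ {w A} t → Below (fresh w) (parsTm t) → NE w (∀' A) → NF w (E! (tm t)) → NE w (A [ t ])
ne-allE {A = A} t bt (neutral d dd dn op wf) (normal e ed en eop) =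
  let wfAt = closedBelow-instance A bt wf in
  neutral (allE t d e) (allE (proj₁ wfAt) dd ed) (allE dn en)
          (λ { (allE₁ p) → op p ; (allE₂ p) → eop p }) wfAt

ne-⊥E : ∀ {w A} → Atomic A → ClosedBelow (fresh w) A → NE w ⊥' → NE w A
ne-⊥E {A = A} at wfA (neutral d dd dn op _) =
  neutral (⊥E A d) (⊥E (proj₁ wfA) at dd) (⊥E dn) (λ { (⊥E p) → op p }) wfA

ne-≐E : ∀ {w} A t₁ t₂ → Atomic A → t₁ ≢ t₂ → ClosedBelow (fresh w) (A [ t₂ ])
        → NE w (tm t₁ ≐ tm t₂) → NF w (A [ t₁ ]) → NE w (A [ t₂ ])
ne-≐E A t₁ t₂ at t₁≢t₂ wf (neutral d dd dn op _) (normal e ed en eop) =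
  neutral (≐E A t₁ t₂ d e) (≐E (proj₁ wf) at t₁≢t₂ dd ed) (≐E dn en)
          (λ { (≐E₁ p) → op p ; (≐E₂ p) → eop p }) wf

nf-∨E : ∀ {w A B C wfA wfB} → Closed C → NE w (A ∨' B)
        → NF (assume w A wfA) C → NF (assume w B wfB) C → NF w C
nf-∨E clC (neutral d dd dn op _) (normal e ed en eop) (normal f fd fn fop) =
  normal (∨E 0 0 d e f) (∨E clC dd ed fd) (∨E dn en fn)
         λ { (∨E₀ p) → op p ; (∨E₁ p p≢) → ∈-∷-≢ (eop p) p≢ ; (∨E₂ p p≢) → ∈-∷-≢ (fop p) p≢ }

nf-exE : ∀ {w A C wfA} → ClosedBelow (fresh w) C → NE w (∃' A) → NF (witness w A wfA) C → NF w C
nf-exE {w} (clC , bC) (neutral d dd dn op (_ , bA)) (normal e ed en eop) =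
  normal (exE 0 0 (fresh w) d e)
         (exE clC (below-fresh bA) (below-fresh bC)
              (λ p p≢₁ p≢₂ → fresh-∉-hyps {w} (undischarged p p≢₁ p≢₂)) dd ed)
         (exE dn en)
         λ { (exE₀ p) → op p ; (exE₁ p p≢₁ p≢₂) → undischarged p p≢₁ p≢₂ }
  where
  undischarged : ∀ {p} → p ∈ass e → p ≢ _ → p ≢ _ → p ∈ hyps w
  undischarged p p≢₁ p≢₂ = ∈-∷-≢ (∈-∷-≢ (eop p) p≢₁) p≢₂

nf-∧I : ∀ {w A B} → Closed (A ∧' B) → NF w A → NF w B → NF w (A ∧' B)
nf-∧I cl (normal d dd dn op) (normal e ed en eop) =
  normal (∧I d e) (∧I cl dd ed) (∧I dn en) λ { (∧I₁ p) → op p ; (∧I₂ p) → eop p }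

nf-∨I₁ : ∀ {w A B} → Closed (A ∨' B) → NF w A → NF w (A ∨' B)
nf-∨I₁ {B = B} cl (normal d dd dn op) = normal (∨I₁ B d) (∨I₁ cl dd) (∨I₁ dn) λ { (∨I₁ p) → op p }

nf-∨I₂ : ∀ {w A B} → Closed (A ∨' B) → NF w B → NF w (A ∨' B)
nf-∨I₂ {A = A} cl (normal d dd dn op) = normal (∨I₂ A d) (∨I₂ cl dd) (∨I₂ dn) λ { (∨I₂ p) → op p }

nf-⇒I : ∀ {w A B wfA} → Closed (A ⇒' B) → NF (assume w A wfA) B → NF w (A ⇒' B)
nf-⇒I {A = A} cl (normal d dd dn op) =
  normal (⇒I 0 A d) (⇒I cl dd) (⇒I dn) λ { (⇒I p p≢) → ∈-∷-≢ (op p) p≢ }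

nf-⇔I : ∀ {w A B wfA wfB} → Closed (A ⇔' B) → NF (assume w A wfA) B → NF (assume w B wfB) A → NF w (A ⇔' B)
nf-⇔I {A = A} {B} cl (normal d dd dn op) (normal e ed en eop) =
  normal (⇔I 0 0 A B d e) (⇔I cl dd ed) (⇔I dn en)
         λ { (⇔I₁ p p≢) → ∈-∷-≢ (op p) p≢ ; (⇔I₂ p p≢) → ∈-∷-≢ (eop p) p≢ }

nf-allI : ∀ {w A} → ClosedBelow (fresh w) (∀' A) → NF (newPar w) (A [ par (fresh w) ]) → NF w (∀' A)
nf-allI {w} (cl , b) (normal d dd dn op) =
  normal (allI 0 (fresh w) d) (allI cl (below-fresh b) (fresh-∉-hyps {w} ∘ opens⊆) dd) (allI dn) opens⊆
  where
  opens⊆ : OpenIn (hyps w) (allI 0 (fresh w) d)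
  opens⊆ (allI p p≢) = ∈-∷-≢ (op p) p≢

nf-exI : ∀ {w A t} → Closed (∃' A) → NF w (A [ t ]) → NF w (E! (tm t)) → NF w (∃' A)
nf-exI {A = A} {t} cl (normal d dd dn op) (normal e ed en eop) =
  normal (exI A t d e) (exI cl dd ed) (exI dn en) λ { (exI₁ p) → op p ; (exI₂ p) → eop p }

nf-≐I : ∀ {w} t → NF w (tm t ≐ tm t)
nf-≐I t = normal (≐I t) ≐I ≐I λ ()

-- Covers and the Kripke semantics

-- Case splits by ∨E and ∃E on neutral deductions; reification turns them
-- into the del-rules of the normal form.
data Cover (P : World → Set) : World → Set where
  leaf   : ∀ {w} → P w → Cover P w
  split∨ : ∀ {w A B} → NE w (A ∨' B)
           → (∀ {w′} → w ≤W w′ → ∀ wfA → Cover P (assume w′ A wfA))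
           → (∀ {w′} → w ≤W w′ → ∀ wfB → Cover P (assume w′ B wfB))
           → Cover P w
  split∃ : ∀ {w A} → NE w (∃' A)
           → (∀ {w′} → w ≤W w′ → ∀ wfA → Cover P (witness w′ A wfA))
           → Cover P w

Mono : (World → Set) → Set
Mono P = ∀ {w w′} → w ≤W w′ → P w → P w′

cover-mono : ∀ {P} → Mono P → Mono (Cover P)
cover-mono mono w≤w′ (leaf p)          = leaf (mono w≤w′ p)
cover-mono mono w≤w′ (split∨ n k₁ k₂) =
  split∨ (ne-mono w≤w′ n) (λ w′≤ → k₁ (≤W-trans w≤w′ w′≤)) (λ w′≤ → k₂ (≤W-trans w≤w′ w′≤))
cover-mono mono w≤w′ (split∃ n k)      = split∃ (ne-mono w≤w′ n) (λ w′≤ → k (≤W-trans w≤w′ w′≤))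

cover-bind : ∀ {P Q w} → Cover P w → (∀ {w′} → w ≤W w′ → P w′ → Cover Q w′) → Cover Q w
cover-bind (leaf p)         k = k ≤W-refl p
cover-bind (split∨ n k₁ k₂) k =
  split∨ n (λ w≤w′ wfA → cover-bind (k₁ w≤w′ wfA) λ ≤w″ → k (≤W-trans w≤w′ (≤W-trans assume-≤ ≤w″)))
           (λ w≤w′ wfB → cover-bind (k₂ w≤w′ wfB) λ ≤w″ → k (≤W-trans w≤w′ (≤W-trans assume-≤ ≤w″)))
cover-bind (split∃ n k₁)    k =
  split∃ n (λ w≤w′ wfA → cover-bind (k₁ w≤w′ wfA) λ ≤w″ → k (≤W-trans w≤w′ (≤W-trans witness-≤ ≤w″)))

cover-map : ∀ {P Q w} → (∀ {w′} → P w′ → Q w′) → Cover P w → Cover Q w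
cover-map f c = cover-bind c (λ _ → leaf ∘ f)

cover-nf : ∀ {P w C} → ClosedBelow (fresh w) C → Cover P w
           → (∀ {w′} → w ≤W w′ → P w′ → NF w′ C) → NF w C
cover-nf wfC (leaf p) k = k ≤W-refl p
cover-nf wfC (split∨ {A = A} {B} n k₁ k₂) k =
  let wfA , wfB = closedBelow-split A B (NE.wf n) in
  nf-∨E (proj₁ wfC) n (cover-nf wfC (k₁ ≤W-refl wfA) (λ ≤w′ → k (≤W-trans assume-≤ ≤w′)))
                      (cover-nf wfC (k₂ ≤W-refl wfB) (λ ≤w′ → k (≤W-trans assume-≤ ≤w′)))
cover-nf {C = C} wfC (split∃ n k₁) k =
  nf-exE wfC n (cover-nf (closedBelow-mono C (n≤1+n _) wfC) (k₁ ≤W-refl (NE.wf n))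
                         (λ ≤w′ → k (≤W-trans witness-≤ ≤w′)))

-- The second summand validates =I, whose instances are normal but not neutral.
Base : Formula → World → Set
Base C w = NE w C ⊎ Σ Term λ t → C ≡ (tm t ≐ tm t)

base-mono : ∀ {C} → Mono (Base C)
base-mono w≤w′ (inj₁ n) = inj₁ (ne-mono w≤w′ n)
base-mono w≤w′ (inj₂ r) = inj₂ r

base-nf : ∀ {w C} → Base C w → NF w C
base-nf (inj₁ n)         = ne⇒nf n
base-nf (inj₂ (t , refl)) = nf-≐I t

Exists : Term → World → Set
Exists t w = Below (fresh w) (parsTm t) × Cover (Base (E! (tm t))) w

exists-mono : ∀ {t} → Mono (Exists t)
exists-mono {t} w≤w′ (bt , e) = below-mono (fresh-≤ w≤w′) bt , cover-mono base-mono w≤w′ e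

Kripke : (World → Set) → (World → Set) → World → Set
Kripke P Q w = ∀ {w′} → w ≤W w′ → P w′ → Q w′

kripke-mono : ∀ {P Q} → Mono (Kripke P Q)
kripke-mono w≤w′ f w′≤ = f (≤W-trans w≤w′ w′≤)

-- The junk value ⊥' is never reached: the semantics only projects
-- formulas of the matching shape.
left right body : Formula → Formula
left (A ∧' B) = A
left (A ∨' B) = A
left (A ⇒' B) = A
left (A ⇔' B) = A
left _        = ⊥'
right (A ∧' B) = B
right (A ∨' B) = B
right (A ⇒' B) = B
right (A ⇔' B) = B
right _        = ⊥'
body (∀' A) = A
body (∃' A) = A
body _      = ⊥'

Sem : Shape → Formula → World → Set
Sem base      C = Cover (Base C)
Sem (and s t) C = λ w → Sem s (left C) w × Sem t (right C) w
Sem (or s t)  C = Cover (λ w → Sem s (left C) w ⊎ Sem t (right C) w)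
Sem (imp s t) C = Kripke (Sem s (left C)) (Sem t (right C))
Sem (iff s t) C = λ w → Kripke (Sem s (left C)) (Sem t (right C)) w
                      × Kripke (Sem t (right C)) (Sem s (left C)) w
Sem (all s)   C = λ w → ∀ {w′} → w ≤W w′ → ∀ t → Exists t w′ → Sem s (body C [ t ]) w′
Sem (ex s)    C = Cover (λ w → Σ Term λ t → Exists t w × Sem s (body C [ t ]) w)

⟦_⟧ : Formula → World → Set
⟦ C ⟧ = Sem (shape C) C

sem-mono : ∀ s {C} → Mono (Sem s C)
sem-mono base      w≤w′ c       = cover-mono base-mono w≤w′ c
sem-mono (and s t) w≤w′ (x , y) = sem-mono s w≤w′ x , sem-mono t w≤w′ y
sem-mono (or s t)  w≤w′ c       =
  cover-mono (λ { ≤w (inj₁ x) → inj₁ (sem-mono s ≤w x) ; ≤w (inj₂ y) → inj₂ (sem-mono t ≤w y) }) w≤w′ c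
sem-mono (imp s t) w≤w′ f       = kripke-mono w≤w′ f
sem-mono (iff s t) w≤w′ (f , g) = kripke-mono w≤w′ f , kripke-mono w≤w′ g
sem-mono (all s)   w≤w′ f       = λ w′≤ → f (≤W-trans w≤w′ w′≤)
sem-mono (ex s)    w≤w′ c       =
  cover-mono (λ { ≤w (t , e , x) → t , exists-mono ≤w e , sem-mono s ≤w x }) w≤w′ c

⟦⟧-mono : ∀ C → Mono ⟦ C ⟧
⟦⟧-mono C = sem-mono (shape C)

paste-kripke : ∀ {P Q w} → Mono P → (∀ {w′} → Cover Q w′ → Q w′) → Cover (Kripke P Q) w → Kripke P Q w
paste-kripke mono paste c w≤w′ a =
  paste (cover-bind (cover-mono kripke-mono w≤w′ c) λ ≤w″ f → leaf (f ≤W-refl (mono ≤w″ a)))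

paste : ∀ s {C w} → Cover (Sem s C) w → Sem s C w
paste base      c = cover-bind c (λ _ x → x)
paste (and s t) c = paste s (cover-map proj₁ c) , paste t (cover-map proj₂ c)
paste (or s t)  c = cover-bind c (λ _ x → x)
paste (imp s t) c = paste-kripke (sem-mono s) (paste t) c
paste (iff s t) c = paste-kripke (sem-mono s) (paste t) (cover-map proj₁ c) ,
                    paste-kripke (sem-mono t) (paste s) (cover-map proj₂ c)
paste (all s)   {C} c w≤w′ t e =
  paste s (cover-bind (cover-mono (sem-mono (all s) {C}) w≤w′ c) λ ≤w″ f → leaf (f ≤W-refl t (exists-mono ≤w″ e)))
paste (ex s)    c = cover-bind c (λ _ x → x)

-- Reflection, reification and evaluation

data BinaryView (op : Formula → Formula → Formula) (s t : Shape) : Formula → Set where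
  view : ∀ {A B} → shape A ≡ s → shape B ≡ t → BinaryView op s t (op A B)

data QuantifierView (q : Formula → Formula) (s : Shape) : Formula → Set where
  view : ∀ {A} → shape A ≡ s → QuantifierView q s (q A)

∧-view : ∀ {C s t} → shape C ≡ and s t → BinaryView _∧'_ s t C
∧-view {_ ∧' _} refl = view refl refl

∨-view : ∀ {C s t} → shape C ≡ or s t → BinaryView _∨'_ s t C
∨-view {_ ∨' _} refl = view refl refl

⇒-view : ∀ {C s t} → shape C ≡ imp s t → BinaryView _⇒'_ s t C
⇒-view {_ ⇒' _} refl = view refl refl

⇔-view : ∀ {C s t} → shape C ≡ iff s t → BinaryView _⇔'_ s t C
⇔-view {_ ⇔' _} refl = view refl refl

∀-view : ∀ {C s} → shape C ≡ all s → QuantifierView ∀' s C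
∀-view {∀' _} refl = view refl

∃-view : ∀ {C s} → shape C ≡ ex s → QuantifierView ∃' s C
∃-view {∃' _} refl = view refl

reflect : ∀ s {w C} → shape C ≡ s → NE w C → Sem s C w
reify   : ∀ s {w C} → shape C ≡ s → ClosedBelow (fresh w) C → Sem s C w → NF w C

reflect base _ n = leaf (inj₁ n)
reflect (and s t) e n with ∧-view e
... | view eA eB = reflect s eA (ne-∧E₁ n) , reflect t eB (ne-∧E₂ n)
reflect (or s t) e n with ∨-view e
... | view eA eB = split∨ n (λ _ _ → leaf (inj₁ (reflect s eA (ne-hyp (here refl)))))
                            (λ _ _ → leaf (inj₂ (reflect t eB (ne-hyp (here refl)))))
reflect (imp s t) e n with ⇒-view e
... | view {A} {B} eA eB = λ w≤w′ a →
  let n′ = ne-mono w≤w′ n ; wfA , _ = closedBelow-split A B (NE.wf n′) in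
  reflect t eB (ne-⇒E n′ (reify s eA wfA a))
reflect (iff s t) e n with ⇔-view e
... | view {A} {B} eA eB =
  (λ w≤w′ a → let n′ = ne-mono w≤w′ n ; wfA , _ = closedBelow-split A B (NE.wf n′) in
              reflect t eB (ne-⇔E₁ n′ (reify s eA wfA a))) ,
  (λ w≤w′ b → let n′ = ne-mono w≤w′ n ; _ , wfB = closedBelow-split A B (NE.wf n′) in
              reflect s eA (ne-⇔E₂ n′ (reify t eB wfB b)))
reflect (all s) e n with ∀-view e
... | view {A} eA = λ w≤w′ u (bu , eu) →
  reflect s (trans (shape-subst 0 u A) eA) (ne-allE u bu (ne-mono w≤w′ n) (reify base refl (tt , bu) eu))
reflect (ex s) e n with ∃-view e
... | view {A} eA =
  split∃ n (λ {w′} _ _ → leaf (par (fresh w′) , (≤-refl ∷ [] , leaf (inj₁ (ne-hyp (there (here refl)))))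
                                , reflect s (trans (shape-subst 0 _ A) eA) (ne-hyp (here refl))))

reify base _ wfC c = cover-nf wfC c (λ _ → base-nf)
reify (and s t) e wf (x , y) with ∧-view e
... | view {A} {B} eA eB =
  let wfA , wfB = closedBelow-split A B wf in
  nf-∧I (proj₁ wf) (reify s eA wfA x) (reify t eB wfB y)
reify (or s t) e wf c with ∨-view e
... | view {A} {B} eA eB =
  let wfA , wfB = closedBelow-split A B wf in
  cover-nf wf c λ { w≤w′ (inj₁ x) → nf-∨I₁ (proj₁ wf) (reify s eA (closedBelow-mono A (fresh-≤ w≤w′) wfA) x)
                  ; w≤w′ (inj₂ y) → nf-∨I₂ (proj₁ wf) (reify t eB (closedBelow-mono B (fresh-≤ w≤w′) wfB) y) }
reify (imp s t) e wf f with ⇒-view e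
... | view {A} {B} eA eB =
  let wfA , wfB = closedBelow-split A B wf in
  nf-⇒I (proj₁ wf) (reify t eB wfB (f (assume-≤ {wfA = wfA}) (reflect s eA (ne-hyp (here refl)))))
reify (iff s t) e wf (f , g) with ⇔-view e
... | view {A} {B} eA eB =
  let wfA , wfB = closedBelow-split A B wf in
  nf-⇔I (proj₁ wf) (reify t eB wfB (f (assume-≤ {wfA = wfA}) (reflect s eA (ne-hyp (here refl)))))
                   (reify s eA wfA (g (assume-≤ {wfA = wfB}) (reflect t eB (ne-hyp (here refl)))))
reify (all s) {w} e wf f with ∀-view e
... | view {A} eA =
  let a = par (fresh w) in
  nf-allI wf (reify s (trans (shape-subst 0 a A) eA)
                      (closedBelow-instance A (≤-refl ∷ []) (closedBelow-mono (∀' A) (n≤1+n _) wf))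
                      (f newPar-≤ a (≤-refl ∷ [] , leaf (inj₁ (ne-hyp (here refl))))))
reify (ex s) e wf c with ∃-view e
... | view {A} eA =
  cover-nf wf c λ { w≤w′ (u , (bu , eu) , x) →
    nf-exI (proj₁ wf) (reify s (trans (shape-subst 0 u A) eA)
                               (closedBelow-instance A bu (closedBelow-mono (∃' A) (fresh-≤ w≤w′) wf)) x)
                      (reify base refl (tt , bu) eu) }

update : (ℕ → Term) → ℕ → Term → ℕ → Term
update σ a t b with b ℕ.≟ a
... | yes _ = t
... | no  _ = σ b

update-≡ : ∀ σ a t → update σ a t a ≡ t
update-≡ σ a t with a ℕ.≟ a
... | yes _   = refl
... | no  a≢a = ⊥-elim (a≢a refl)

update-≢ : ∀ σ {a} t {b} → b ≢ a → update σ a t b ≡ σ b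
update-≢ σ {a} t {b} b≢a with b ℕ.≟ a
... | yes b≡a = ⊥-elim (b≢a b≡a)
... | no  _   = refl

update-below : ∀ {n σ a t} → BelowSubst n σ → Below n (parsTm t) → BelowSubst n (update σ a t)
update-below {σ = σ} {a} bσ bt b with b ℕ.≟ a
... | yes _ = bt
... | no  _ = bσ b

psubst-update-fresh : ∀ σ {a} t B → ¬ (a occursIn B) → psubst (update σ a t) B ≡ psubst σ B
psubst-update-fresh σ t B a∉B = psubst-cong B (All.tabulate λ b∈B → update-≢ σ t λ { refl → a∉B b∈B })

psubst-update-instance : ∀ σ {a} t A → ¬ (a occursIn A)
                         → psubst (update σ a t) (A [ par a ]) ≡ psubst σ A [ t ]
psubst-update-instance σ {a} t A a∉A =
  trans (psubst-subst (update σ a t) 0 (par a) A)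
        (cong₂ (subst 0) (update-≡ σ a t) (psubst-update-fresh σ t A a∉A))

cast : ∀ {A B w} → A ≡ B → ⟦ A ⟧ w → ⟦ B ⟧ w
cast {w = w} A≡B = transport (λ X → ⟦ X ⟧ w) A≡B

sem-instance⁺ : ∀ {w} A t → ⟦ A [ t ] ⟧ w → Sem (shape A) (A [ t ]) w
sem-instance⁺ {w} A t = transport (λ s → Sem s (A [ t ]) w) (shape-subst 0 t A)

sem-instance⁻ : ∀ {w} A t → Sem (shape A) (A [ t ]) w → ⟦ A [ t ] ⟧ w
sem-instance⁻ {w} A t = transport (λ s → Sem s (A [ t ]) w) (sym (shape-subst 0 t A))

sem-atomic⁺ : ∀ {w C} → Atomic C → ⟦ C ⟧ w → Cover (Base C) w
sem-atomic⁺ (rel n ts) c = c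
sem-atomic⁺ (E! t)     c = c
sem-atomic⁺ (eq s t)   c = c

sem-atomic⁻ : ∀ {w C} → Atomic C → Cover (Base C) w → ⟦ C ⟧ w
sem-atomic⁻ (rel n ts) c = c
sem-atomic⁻ (E! t)     c = c
sem-atomic⁻ (eq s t)   c = c

Valuation : (Assumption → Set) → (ℕ → Term) → World → Set
Valuation P σ w = ∀ {p} → P p → ⟦ psubst σ (proj₂ p) ⟧ w

Env : ∀ {C} → Der C → (ℕ → Term) → World → Set
Env d = Valuation (_∈ass d)

_∖_ : (Assumption → Set) → Assumption → Assumption → Set
(P ∖ q) p = P p × p ≢ q

extendᵛ : ∀ {P σ w} q → ⟦ psubst σ (proj₂ q) ⟧ w → Valuation (P ∖ q) σ w → Valuation P σ w
extendᵛ q x ρ {p} Pp with p ≟Ass q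
... | yes refl = x
... | no  p≢q  = ρ (Pp , p≢q)

env-mono : ∀ {C} {d : Der C} {σ w w′} → w ≤W w′ → Env d σ w → Env d σ w′
env-mono {σ = σ} w≤w′ ρ {_ , B} p = ⟦⟧-mono (psubst σ B) w≤w′ (ρ p)

valuation-update : ∀ {P σ w a t} → (∀ {p} → P p → ¬ (a occursIn proj₂ p))
                   → Valuation P σ w → Valuation P (update σ a t) w
valuation-update {σ = σ} {t = t} fresh ρ {p} Pp = cast (sym (psubst-update-fresh σ t (proj₂ p) (fresh Pp))) (ρ Pp)

-- A parameter substitution may identify the two sides of an equation,
-- in which case =E is not applicable and not needed either.
cover-≐E : ∀ {w} X s₁ s₂ → Atomic X → ClosedBelow (fresh w) (X [ s₂ ])
           → Cover (Base (tm s₁ ≐ tm s₂)) w → Cover (Base (X [ s₁ ])) w → Cover (Base (X [ s₂ ])) w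
cover-≐E {w} X s₁ s₂ at wf eqn c = cover-bind eqn rewrite-with
  where
  rewrite-with : ∀ {w′} → w ≤W w′ → Base (tm s₁ ≐ tm s₂) w′ → Cover (Base (X [ s₂ ])) w′
  rewrite-with w≤w′ (inj₂ (_ , refl)) = cover-mono base-mono w≤w′ c
  rewrite-with w≤w′ (inj₁ n) with s₁ ≟Tm s₂
  ... | yes refl   = cover-mono base-mono w≤w′ c
  ... | no s₁≢s₂ = cover-bind (cover-mono base-mono w≤w′ c) λ w′≤ m →
    leaf (inj₁ (ne-≐E X s₁ s₂ at s₁≢s₂ (closedBelow-mono (X [ s₂ ]) (fresh-≤ (≤W-trans w≤w′ w′≤)) wf)
                      (ne-mono w′≤ n) (base-nf m)))

belowSubst-mono : ∀ {m n σ} → m ≤ n → BelowSubst m σ → BelowSubst n σ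
belowSubst-mono m≤n bσ b = below-mono m≤n (bσ b)

Sound : ∀ {C} → Der C → Set
Sound {C} d = ∀ {w} σ → BelowSubst (fresh w) σ → Env d σ w → ⟦ psubst σ C ⟧ w

sound-⇒I : ∀ {u A B} {d : Der B} → Sound d → Sound (⇒I u A d)
sound-⇒I {u} {A} sd σ bσ ρ w≤w′ a =
  sd σ (belowSubst-mono (fresh-≤ w≤w′) bσ) (extendᵛ (u , A) a λ (p , p≢) → env-mono w≤w′ ρ (⇒I p p≢))

sound-∨E : ∀ {u v A B C} {d : Der (A ∨' B)} {e f : Der C} → Sound d → Sound e → Sound f → Sound (∨E u v d e f)
sound-∨E {u} {v} {A} {B} {C} sd se sf σ bσ ρ =
  paste (shape (psubst σ C)) (cover-bind (sd σ bσ (λ p → ρ (∨E₀ p))) λ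
    { w≤w′ (inj₁ a) → leaf (se σ (belowSubst-mono (fresh-≤ w≤w′) bσ)
                               (extendᵛ (u , A) a λ (p , p≢) → env-mono w≤w′ ρ (∨E₁ p p≢)))
    ; w≤w′ (inj₂ b) → leaf (sf σ (belowSubst-mono (fresh-≤ w≤w′) bσ)
                               (extendᵛ (v , B) b λ (p , p≢) → env-mono w≤w′ ρ (∨E₂ p p≢))) })

sound-⇔I : ∀ {u v A B} {d : Der B} {e : Der A} → Sound d → Sound e → Sound (⇔I u v A B d e)
sound-⇔I {u} {v} {A} {B} sd se σ bσ ρ =
  (λ w≤w′ a → sd σ (belowSubst-mono (fresh-≤ w≤w′) bσ)
                (extendᵛ (u , A) a λ (p , p≢) → env-mono w≤w′ ρ (⇔I₁ p p≢))) ,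
  (λ w≤w′ b → se σ (belowSubst-mono (fresh-≤ w≤w′) bσ)
                (extendᵛ (v , B) b λ (p , p≢) → env-mono w≤w′ ρ (⇔I₂ p p≢)))

sound-⊥E : ∀ {A} {d : Der ⊥'} → Closed A → Atomic A → Sound d → Sound (⊥E A d)
sound-⊥E {A} cl at sd σ bσ ρ =
  sem-atomic⁻ at′ (cover-bind (sd σ bσ (λ p → ρ (⊥E p))) λ
    { w≤w′ (inj₁ n) →
        leaf (inj₁ (ne-⊥E at′ (wf-psubst σ 0 A cl , psubst-below (belowSubst-mono (fresh-≤ w≤w′) bσ) A) n))
    ; _ (inj₂ (_ , ())) })
  where at′ = atomic-psubst σ at

sound-allI : ∀ {u a A} {d : Der (A [ par a ])} → ¬ (a occursIn A)
             → (∀ {v B} → (v , B) ∈ass allI u a d → ¬ (a occursIn B)) → Sound d → Sound (allI u a d)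
sound-allI {u} {a} {A} a∉A a∉hyps sd σ bσ ρ {w′} w≤w′ t (bt , e) =
  sem-instance⁺ (psubst σ A) t (cast (psubst-update-instance σ t A a∉A)
    (sd (update σ a t) (update-below (belowSubst-mono (fresh-≤ w≤w′) bσ) bt)
      (extendᵛ (u , E! (tm (par a))) (cast (cong (λ s → E! (tm s)) (sym (update-≡ σ a t))) e) outer)))
  where
  outer : Valuation ((_∈ass _) ∖ (u , E! (tm (par a)))) (update σ a t) w′
  outer = valuation-update {P = (_∈ass _) ∖ _} (λ (p , p≢) → a∉hyps (allI p p≢))
                                                 λ (p , p≢) → env-mono w≤w′ ρ (allI p p≢)

sound-allE : ∀ {A t} {d : Der (∀' A)} {e : Der (E! (tm t))} → Sound d → Sound e → Sound (allE t d e)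
sound-allE {A} {t} sd se σ bσ ρ =
  cast (sym (psubst-subst σ 0 t A))
    (sem-instance⁻ (psubst σ A) (psubstT σ t)
      (sd σ bσ (λ p → ρ (allE₁ p)) ≤W-refl (psubstT σ t) (psubstT-below bσ t , se σ bσ (λ p → ρ (allE₂ p)))))

sound-exI : ∀ {A t} {d : Der (A [ t ])} {e : Der (E! (tm t))} → Sound d → Sound e → Sound (exI A t d e)
sound-exI {A} {t} sd se σ bσ ρ =
  leaf (psubstT σ t , (psubstT-below bσ t , se σ bσ (λ p → ρ (exI₂ p)))
       , sem-instance⁺ (psubst σ A) (psubstT σ t) (cast (psubst-subst σ 0 t A) (sd σ bσ (λ p → ρ (exI₁ p)))))

sound-exE : ∀ {u v a A C} {d : Der (∃' A)} {e : Der C} → ¬ (a occursIn A) → ¬ (a occursIn C)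
            → (∀ {p} → p ∈ass e → p ≢ (u , A [ par a ]) → p ≢ (v , E! (tm (par a))) → ¬ (a occursIn proj₂ p))
            → Sound d → Sound e → Sound (exE u v a d e)
sound-exE {u} {v} {a} {A} {C} a∉A a∉C a∉hyps sd se σ bσ ρ =
  paste (shape (psubst σ C)) (cover-bind (sd σ bσ (λ p → ρ (exE₀ p))) λ w≤w′ (t , (bt , e) , x) →
    leaf (cast (psubst-update-fresh σ t C a∉C)
      (se (update σ a t) (update-below (belowSubst-mono (fresh-≤ w≤w′) bσ) bt)
        (extendᵛ (u , A [ par a ]) (cast (sym (psubst-update-instance σ t A a∉A)) (sem-instance⁻ (psubst σ A) t x))
          (extendᵛ (v , E! (tm (par a))) (cast (cong (λ s → E! (tm s)) (sym (update-≡ σ a t))) e)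
            (outer w≤w′))))))
  where
  outer : ∀ {w′ t} → _ ≤W w′
          → Valuation (((_∈ass _) ∖ (u , A [ par a ])) ∖ (v , E! (tm (par a)))) (update σ a t) w′
  outer w≤w′ = valuation-update {P = ((_∈ass _) ∖ _) ∖ _} (λ ((p , p≢₁) , p≢₂) → a∉hyps p p≢₁ p≢₂)
                                 λ ((p , p≢₁) , p≢₂) → env-mono w≤w′ ρ (exE₁ p p≢₁ p≢₂)

sound-≐E : ∀ {A t₁ t₂} {d : Der (tm t₁ ≐ tm t₂)} {e : Der (A [ t₁ ])} → Closed (A [ t₂ ]) → Atomic A
           → Sound d → Sound e → Sound (≐E A t₁ t₂ d e)
sound-≐E {A} {t₁} {t₂} cl at sd se σ bσ ρ =
  cast (sym (psubst-subst σ 0 t₂ A))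
    (sem-atomic⁻ (atomic-subst 0 s₂ at′)
      (cover-≐E (psubst σ A) s₁ s₂ at′ wf (sd σ bσ (λ p → ρ (≐E₁ p)))
        (sem-atomic⁺ (atomic-subst 0 s₁ at′) (cast (psubst-subst σ 0 t₁ A) (se σ bσ (λ p → ρ (≐E₂ p)))))))
  where
  s₁ = psubstT σ t₁
  s₂ = psubstT σ t₂
  at′ = atomic-psubst σ at
  wf : ClosedBelow _ (psubst σ A [ s₂ ])
  wf = transport Closed (psubst-subst σ 0 t₂ A) (wf-psubst σ 0 (A [ t₂ ]) cl) ,
       subst-below (psubstT-below bσ t₂) 0 (psubst σ A) (psubst-below bσ A)

eval : ∀ {C} {d : Der C} → IsDed d → Sound d
eval (ass _) σ bσ ρ = ρ ass
eval (∧I _ dd ed) σ bσ ρ = eval dd σ bσ (λ p → ρ (∧I₁ p)) , eval ed σ bσ (λ p → ρ (∧I₂ p))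
eval (∧E₁ _ dd) σ bσ ρ = proj₁ (eval dd σ bσ (λ p → ρ (∧E₁ p)))
eval (∧E₂ _ dd) σ bσ ρ = proj₂ (eval dd σ bσ (λ p → ρ (∧E₂ p)))
eval (⇒I _ dd) = sound-⇒I (eval dd)
eval (⇒E _ dd ed) σ bσ ρ = eval dd σ bσ (λ p → ρ (⇒E₁ p)) ≤W-refl (eval ed σ bσ (λ p → ρ (⇒E₂ p)))
eval (∨I₁ _ dd) σ bσ ρ = leaf (inj₁ (eval dd σ bσ (λ p → ρ (∨I₁ p))))
eval (∨I₂ _ dd) σ bσ ρ = leaf (inj₂ (eval dd σ bσ (λ p → ρ (∨I₂ p))))
eval (∨E _ dd ed fd) = sound-∨E (eval dd) (eval ed) (eval fd)
eval (⇔I _ dd ed) = sound-⇔I (eval dd) (eval ed)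
eval (⇔E₁ _ dd ed) σ bσ ρ = proj₁ (eval dd σ bσ (λ p → ρ (⇔E₁₁ p))) ≤W-refl (eval ed σ bσ (λ p → ρ (⇔E₁₂ p)))
eval (⇔E₂ _ dd ed) σ bσ ρ = proj₂ (eval dd σ bσ (λ p → ρ (⇔E₂₁ p))) ≤W-refl (eval ed σ bσ (λ p → ρ (⇔E₂₂ p)))
eval (⊥E cl at dd) = sound-⊥E cl at (eval dd)
eval (allI _ a∉A a∉hyps dd) = sound-allI a∉A a∉hyps (eval dd)
eval (allE _ dd ed) = sound-allE (eval dd) (eval ed)
eval (exI _ dd ed) = sound-exI (eval dd) (eval ed)
eval (exE _ a∉A a∉C a∉hyps dd ed) = sound-exE a∉A a∉C a∉hyps (eval dd) (eval ed)
eval (≐I {t}) σ bσ ρ = leaf (inj₂ (psubstT σ t , refl))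
eval (≐E cl at _ dd ed) = sound-≐E cl at (eval dd) (eval ed)

-- Evaluation needs the values of a substitution to stay below the bound;
-- on the parameters that occur, truncate n is the identity.
truncate : ℕ → ℕ → Term
truncate n a with a ℕ.<? n
... | yes _ = par a
... | no  _ = con 0

truncate-below : ∀ n → BelowSubst n (truncate n)
truncate-below n a with a ℕ.<? n
... | yes a<n = a<n ∷ []
... | no  _   = []

psubst-truncate : ∀ {n} A → Below n (pars A) → psubst (truncate n) A ≡ A
psubst-truncate {n} A b = trans (psubst-cong A (All.map truncate-par b)) (psubst-id A)
  where
  truncate-par : ∀ {a} → a < n → truncate n a ≡ par a
  truncate-par {a} a<n with a ℕ.<? n
  ... | yes _   = refl
  ... | no  a≮n = ⊥-elim (a≮n a<n)

module _ {C} (d : Der C) (dd : IsDed d) where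

  private
    bound : ℕ
    bound = suc (max 0 (pars C ++ concatMap (pars ∘ proj₂) (opens d)))

    below-bound : Below bound (pars C ++ concatMap (pars ∘ proj₂) (opens d))
    below-bound = below-max _

    below-opens : All (Below bound ∘ pars ∘ proj₂) (opens d)
    below-opens = map⁻ (concat⁻ (++⁻ʳ (pars C) below-bound))

    opens-wf : All (ClosedBelow bound ∘ proj₂) (opens d)
    opens-wf = All.tabulate λ p∈ → closed-assumption dd (∈opens⇒∈ass d p∈) , All.lookup below-opens p∈

  initialWorld : World
  initialWorld = world (opens d) bound opens-wf

  conclusion-wf : ClosedBelow (fresh initialWorld) C
  conclusion-wf = closed-conclusion dd , ++⁻ˡ (pars C) below-bound

  initialEnv : Env d (truncate bound) initialWorld
  initialEnv {u , B} p =
    let p∈ = ∈ass⇒∈opens p in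
    cast (sym (psubst-truncate B (proj₂ (All.lookup opens-wf p∈)))) (reflect (shape B) refl (ne-hyp p∈))

  normalise : NF initialWorld C
  normalise = reify (shape C) refl conclusion-wf
                (cast (psubst-truncate C (proj₂ conclusion-wf))
                      (eval dd (truncate bound) (truncate-below bound) initialEnv))

theorem1 : ∀ {C} (d : Der C) → IsDed d →
    Σ (Der C) λ d′ → IsDed d′ × Normal d′ ×
      (∀ {u B} → (u , B) ∈ass d′ → ∃ λ v → (v , B) ∈ass d)
theorem1 d dd with normalise d dd
... | normal d′ dd′ nf opens⊆ = d′ , dd′ , nf⇒normal nf , λ {u} p → u , ∈opens⇒∈ass d (opens⊆ p)
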